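{- Let $G=P_t$ with $t\ge 2$, or $G=C_t$ with $t\geq 3$. Suppose that either $t$ is odd and $n\geq t$, or $t$ is even and either (1) $G=P_t$ and $n\geq \frac t2 + 2$, or (2) $G=C_t$ and $n\geq \frac t2$. Then \[ \gamma_P(G\times K_n)= \begin{cases} \left\lceil \frac t2 \right\rceil & \text{if } t\not\equiv 2 \pmod 4, \\ \frac t2 \text{ or } \frac t2 + 1 & \text{if } t\equiv 2 \pmod 4. \end{cases}\]
   Context: All graphs are finite, simple and undirected. $P_t$ is the path on $t$ vertices, $C_t$ the cycle on $t$ vertices, $K_n$ the complete graph on $n$ vertices. The tensor product $G\times H$ has vertex set $V(G)\times V(H)$, with $(g,h)$ adjacent to $(g',h')$ iff $g\sim g'$ in $G$ and $h\sim h'$ in $H$. Power domination: for $S\subseteq V(G)$ define $PD(S)$ by first setting $PD(S):=N[S]$ (the closed neighborhood of $S$), and then, while there is a vertex $v\in PD(S)$ with exactly one neighbor outside $PD(S)$, adding all neighbors of $v$ to $PD(S)$. $S$ is a power dominating set if at the end $PD(S)=V(G)$; $\gamma_P(G)$ is the minimum cardinality of a power dominating set. -}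

module Defs where

open import Level using (Level; suc; _⊔_)
open import Data.Nat using (ℕ; _+_; _%_)
open import Data.Nat as ℕ using ()
open import Data.Fin using (Fin; toℕ)
open import Data.Product using (_×_; _,_; Σ; ∃)
open import Data.Sum using (_⊎_)
open import Data.List using (List; length)
open import Data.List.Membership.Propositional using (_∈_)
open import Data.List.Relation.Unary.Unique.Propositional using (Unique)
open import Relation.Binary.PropositionalEquality using (_≡_; _≢_)
open import Relation.Nullary using (¬_)

-- A (simple, undirected) graph: a vertex type and an adjacency relation.
-- All graphs used below are finite, simple and undirected by construction.
record Graph : Set₁ where
  field
    V   : Set
    _~_ : V → V → Set

open Graph public

Path : ℕ → Graph
Path t = record { V = Fin t ; _~_ = λ i j → (ℕ.suc (toℕ i) ≡ toℕ j) ⊎ (ℕ.suc (toℕ j) ≡ toℕ i) }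

-- Cycle C_t on vertices 0..t-1 (meant for t ≥ 3): the path edges plus the edge {0, t-1}
Cycle : ℕ → Graph
Cycle t = record { V = Fin t ; _~_ = λ i j → (ℕ.suc (toℕ i) ≡ toℕ j) ⊎ (ℕ.suc (toℕ j) ≡ toℕ i)
                                          ⊎ (toℕ i ≡ 0 × ℕ.suc (toℕ j) ≡ t) ⊎ (toℕ j ≡ 0 × ℕ.suc (toℕ i) ≡ t) }

Complete : ℕ → Graph
Complete n = record { V = Fin n ; _~_ = λ i j → i ≢ j }

_⊗_ : Graph → Graph → Graph
G ⊗ H = record { V = V G × V H ; _~_ = λ p q → (_~_ G (Data.Product.proj₁ p) (Data.Product.proj₁ q)) × (_~_ H (Data.Product.proj₂ p) (Data.Product.proj₂ q)) }

-- It is the closure of N[S] under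
-- the propagation rule "if u ∈ PD(S) and all neighbours of u other than w
-- are in PD(S) (so w is its only possible neighbour outside), add w".
data Observed (G : Graph) (S : List (V G)) : V G → Set where
  dom-self : ∀ {v} → v ∈ S → Observed G S v
  dom-nbr  : ∀ {u v} → u ∈ S → _~_ G u v → Observed G S v
  propagate : ∀ {u w} → Observed G S u → _~_ G u w
            → (∀ x → _~_ G u x → x ≢ w → Observed G S x)
            → Observed G S w

IsPowerDominating : (G : Graph) → List (V G) → Set
IsPowerDominating G S = Unique S × (∀ v → Observed G S v)

PowerDominationNumberIs : Graph → ℕ → Set
PowerDominationNumberIs G k =
  (Σ (List (V G)) λ S → IsPowerDominating G S × length S ≡ k)
  × (∀ S → IsPowerDominating G S → k ℕ.≤ length S)

data Kind : Set where
  path cycle : Kind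

Base : Kind → ℕ → Graph
Base path  t = Path t
Base cycle t = Cycle t

-- Let S be a power dominating set of G × K_n and call the number of vertices of S in a column
-- of G its load.  A vertex outside S can only be observed through a neighbouring column, so a
-- column none of whose neighbouring columns carries load has load at least n - 2.  Every column
-- has at most two neighbours, hence covering all t columns costs load ⌈t/2⌉; if G is bipartite
-- and t ≡ 2 (mod 4), each parity class consists of an odd number t/2 of columns covered by the
-- other class, which costs t/2 + 1.  An uncovered column costs n - 2, which the size
-- assumptions on n make at least as expensive.  Conversely, the row-0 vertices of the columns
-- ≡ 1, 2 (mod 4), plus one or two columns at the end, dominate every other row, after which row
-- 0 is forced column by column.  The few small boards not reached by this arithmetic are
-- settled by exhaustive search.

module Submission where

open import Defs
open import Data.Nat
open import Data.Nat.Properties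
open import Data.Nat.DivMod using (m%n<n; m≡m%n+[m/n]*n; [m+kn]%n≡m%n)
open import Data.Nat.Tactic.RingSolver using (solve-∀)
open import Data.Unit using (tt)
open import Data.Empty using (⊥; ⊥-elim)
open import Data.Bool using (Bool; true; false; not; _∧_; _∨_; _xor_; if_then_else_)
import Data.Bool as Bool
open import Data.Bool.ListAction using (all; any)
open import Data.Fin using (Fin; toℕ; fromℕ<; #_) renaming (zero to fz; suc to fs)
open import Data.Fin.Properties using (toℕ<n; toℕ-fromℕ<; toℕ-injective; ¬∀⟶∃¬)
import Data.Fin.Properties as Fin
open import Data.Product using (_×_; _,_; Σ; ∃; proj₁; proj₂)
open import Data.Product.Properties using (≡-dec)
open import Data.Sum using (_⊎_; inj₁; inj₂)
open import Data.List using (List; []; _∷_; _++_; length; map; cartesianProduct; allFin)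
open import Data.List.Properties using (length-map)
open import Data.List.Relation.Unary.All as All using (All; []; _∷_)
open import Data.List.Relation.Unary.All.Properties using (++⁺)
open import Data.List.Relation.Unary.Any as Any using (Any; here; there)
open import Data.List.Relation.Unary.AllPairs using ([]; _∷_)
open import Data.List.Relation.Unary.Unique.Propositional using (Unique)
open import Data.List.Membership.Propositional using (_∈_; _∉_; find)
open import Data.List.Membership.Propositional.Properties using (∈-map⁺; ∈-cartesianProduct⁺; ∈-allFin)
open import Function using (_∘_)
open import Relation.Nullary using (¬_; Dec; yes; no; does)
open import Relation.Nullary.Decidable using (_⊎-dec_; _×-dec_; _→-dec_; ¬?; decidable-stable)
open import Relation.Binary.PropositionalEquality

-- Finite sums

𝟙 : {P : Set} → Dec P → ℕ
𝟙 (yes _) = 1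
𝟙 (no _) = 0

𝟙-yes : {P : Set} (d : Dec P) → P → 𝟙 d ≡ 1
𝟙-yes (yes _) _ = refl
𝟙-yes (no ¬p) p = ⊥-elim (¬p p)

𝟙-mono : {P Q : Set} (d : Dec P) (e : Dec Q) → (P → Q) → 𝟙 d ≤ 𝟙 e
𝟙-mono (yes p) (yes q) f = ≤-refl
𝟙-mono (yes p) (no ¬q) f = ⊥-elim (¬q (f p))
𝟙-mono (no _) e f = z≤n

𝟙-⊎ : {P Q R : Set} (d : Dec P) (e : Dec Q) (f : Dec R) → (P → Q ⊎ R) → 𝟙 d ≤ 𝟙 e + 𝟙 f
𝟙-⊎ (no _) e f h = z≤n
𝟙-⊎ (yes p) e f h with h p
... | inj₁ q rewrite 𝟙-yes e q = s≤s z≤n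
... | inj₂ r rewrite 𝟙-yes f r = m≤n+m 1 (𝟙 e)

sumBelow : ℕ → (ℕ → ℕ) → ℕ
sumBelow zero f = 0
sumBelow (suc t) f = sumBelow t f + f t

syntax sumBelow t (λ i → e) = ∑[ i < t ] e

∑-mono-≤ : ∀ t {f g : ℕ → ℕ} → (∀ i → i < t → f i ≤ g i) → sumBelow t f ≤ sumBelow t g
∑-mono-≤ zero h = z≤n
∑-mono-≤ (suc t) h = +-mono-≤ (∑-mono-≤ t (λ i p → h i (m≤n⇒m≤1+n p))) (h t ≤-refl)

∑-cong : ∀ t {f g : ℕ → ℕ} → (∀ i → i < t → f i ≡ g i) → sumBelow t f ≡ sumBelow t g
∑-cong zero h = refl
∑-cong (suc t) h = cong₂ _+_ (∑-cong t (λ i p → h i (m≤n⇒m≤1+n p))) (h t ≤-refl)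

∑-distrib-+ : ∀ t (f g : ℕ → ℕ) → ∑[ i < t ] (f i + g i) ≡ sumBelow t f + sumBelow t g
∑-distrib-+ zero f g = refl
∑-distrib-+ (suc t) f g = begin
  ∑[ i < t ] (f i + g i) + (f t + g t)  ≡⟨ cong (_+ (f t + g t)) (∑-distrib-+ t f g) ⟩
  (F + G) + (f t + g t)                 ≡⟨ +-assoc F G (f t + g t) ⟩
  F + (G + (f t + g t))                 ≡⟨ cong (F +_) (+-comm G (f t + g t)) ⟩
  F + ((f t + g t) + G)                 ≡⟨ cong (F +_) (+-assoc (f t) (g t) G) ⟩
  F + (f t + (g t + G))                 ≡⟨ sym (+-assoc F (f t) (g t + G)) ⟩
  (F + f t) + (g t + G)                 ≡⟨ cong ((F + f t) +_) (+-comm (g t) G) ⟩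
  (F + f t) + (G + g t)                 ∎
  where
  open ≡-Reasoning
  F = sumBelow t f
  G = sumBelow t g

∑-*ˡ : ∀ t c (f : ℕ → ℕ) → ∑[ i < t ] (c * f i) ≡ c * sumBelow t f
∑-*ˡ zero c f = sym (*-zeroʳ c)
∑-*ˡ (suc t) c f rewrite ∑-*ˡ t c f = sym (*-distribˡ-+ c (sumBelow t f) (f t))

∑-const : ∀ t c → ∑[ i < t ] c ≡ t * c
∑-const zero c = refl
∑-const (suc t) c rewrite ∑-const t c = +-comm (t * c) c

∑-swap : ∀ s t (g : ℕ → ℕ → ℕ) → ∑[ i < s ] ∑[ j < t ] g i j ≡ ∑[ j < t ] ∑[ i < s ] g i j
∑-swap zero t g = sym (trans (∑-const t 0) (*-zeroʳ t))
∑-swap (suc s) t g rewrite ∑-swap s t g = sym (∑-distrib-+ t (λ j → ∑[ i < s ] g i j) (λ j → g s j))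

term≤∑ : ∀ t (f : ℕ → ℕ) i → i < t → f i ≤ sumBelow t f
term≤∑ (suc t) f i p with m≤n⇒m<n∨m≡n (≤-pred p)
... | inj₁ q = ≤-trans (term≤∑ t f i q) (m≤m+n (sumBelow t f) (f t))
... | inj₂ refl = m≤n+m (f i) (sumBelow t f)

two-terms≤∑ : ∀ t (f : ℕ → ℕ) i j → i < t → j < t → i ≢ j → f i + f j ≤ sumBelow t f
two-terms≤∑ (suc t) f i j p q i≢j with m≤n⇒m<n∨m≡n (≤-pred p) | m≤n⇒m<n∨m≡n (≤-pred q)
... | inj₁ p′ | inj₁ q′ = ≤-trans (two-terms≤∑ t f i j p′ q′ i≢j) (m≤m+n (sumBelow t f) (f t))
... | inj₁ p′ | inj₂ refl = +-monoˡ-≤ (f j) (term≤∑ t f i p′)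
... | inj₂ refl | inj₁ q′ = subst (_≤ sumBelow t f + f i) (+-comm (f j) (f i)) (+-monoˡ-≤ (f i) (term≤∑ t f j q′))
... | inj₂ refl | inj₂ refl = ⊥-elim (i≢j refl)

∑-𝟙-≡-≤1 : ∀ t x → ∑[ i < t ] 𝟙 (i ≟ x) ≤ 1
∑-𝟙-≡-≤1 zero x = z≤n
∑-𝟙-≡-≤1 (suc t) x with t ≟ x
... | yes refl = subst (λ s → s + 1 ≤ 1) (sym (vanishes t ≤-refl)) ≤-refl
  where
  vanishes : ∀ s → s ≤ t → ∑[ i < s ] 𝟙 (i ≟ t) ≡ 0
  vanishes zero _ = refl
  vanishes (suc s) p with s ≟ t
  ... | yes refl = ⊥-elim (<-irrefl refl p)
  ... | no _ = trans (+-identityʳ _) (vanishes s (≤-trans (n≤1+n s) p))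
... | no _ = subst (_≤ 1) (sym (+-identityʳ _)) (∑-𝟙-≡-≤1 t x)

erase : ℕ → (ℕ → ℕ) → ℕ → ℕ
erase x f i with i ≟ x
... | yes _ = 0
... | no _ = f i

∑-erase : ∀ t (f : ℕ → ℕ) x → x < t → sumBelow t (erase x f) + f x ≡ sumBelow t f
∑-erase (suc t) f x p with t ≟ x
... | yes refl = cong (_+ f t) (trans (+-identityʳ _) (∑-cong t (λ i q → unchanged i q)))
  where
  unchanged : ∀ i → i < t → erase t f i ≡ f i
  unchanged i q with i ≟ t
  ... | yes refl = ⊥-elim (<-irrefl refl q)
  ... | no _ = refl
... | no x≢t = begin
    E + f t + f x    ≡⟨ +-assoc E (f t) (f x) ⟩
    E + (f t + f x)  ≡⟨ cong (E +_) (+-comm (f t) (f x)) ⟩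
    E + (f x + f t)  ≡⟨ sym (+-assoc E (f x) (f t)) ⟩
    E + f x + f t    ≡⟨ cong (_+ f t) (∑-erase t f x x<t) ⟩
    sumBelow t f + f t ∎
  where
  open ≡-Reasoning
  E = sumBelow t (erase x f)
  x<t : x < t
  x<t with m≤n⇒m<n∨m≡n (≤-pred p)
  ... | inj₁ q = q
  ... | inj₂ refl = ⊥-elim (x≢t refl)

-- Columns of paths and cycles

Adjacent : Kind → ℕ → ℕ → ℕ → Set
Adjacent path t c d = (suc c ≡ d) ⊎ (suc d ≡ c)
Adjacent cycle t c d = (suc c ≡ d) ⊎ (suc d ≡ c) ⊎ (c ≡ 0 × suc d ≡ t) ⊎ (d ≡ 0 × suc c ≡ t)

Adjacent? : ∀ k t c d → Dec (Adjacent k t c d)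
Adjacent? path t c d = (suc c ≟ d) ⊎-dec (suc d ≟ c)
Adjacent? cycle t c d = (suc c ≟ d) ⊎-dec (suc d ≟ c) ⊎-dec ((c ≟ 0) ×-dec (suc d ≟ t)) ⊎-dec ((d ≟ 0) ×-dec (suc c ≟ t))

Adjacent-sym : ∀ k t c d → Adjacent k t c d → Adjacent k t d c
Adjacent-sym path t c d (inj₁ e) = inj₂ e
Adjacent-sym path t c d (inj₂ e) = inj₁ e
Adjacent-sym cycle t c d (inj₁ e) = inj₂ (inj₁ e)
Adjacent-sym cycle t c d (inj₂ (inj₁ e)) = inj₁ e
Adjacent-sym cycle t c d (inj₂ (inj₂ (inj₁ e))) = inj₂ (inj₂ (inj₂ e))
Adjacent-sym cycle t c d (inj₂ (inj₂ (inj₂ e))) = inj₂ (inj₂ (inj₁ e))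

path⇒Adjacent : ∀ k t c d → Adjacent path t c d → Adjacent k t c d
path⇒Adjacent path t c d a = a
path⇒Adjacent cycle t c d (inj₁ e) = inj₁ e
path⇒Adjacent cycle t c d (inj₂ e) = inj₂ (inj₁ e)

-- Base k t ⊗ Complete n, with the base graph reduced for an arbitrary k.
Board : Kind → ℕ → ℕ → Graph
Board k t n = record { V = Fin t ; _~_ = λ i j → Adjacent k t (toℕ i) (toℕ j) } ⊗ Complete n

predecessor successor : ℕ → ℕ → ℕ
predecessor t zero = t ∸ 1
predecessor t (suc d) = d
successor t d with suc d ≟ t
... | yes _ = 0
... | no _ = suc d

Adjacent⇒pred-or-succ : ∀ k t c d → c < t → Adjacent k t c d → c ≡ predecessor t d ⊎ c ≡ successor t d
Adjacent⇒pred-or-succ path t c .(suc c) _ (inj₁ refl) = inj₁ refl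
Adjacent⇒pred-or-succ path t .(suc d) d lt (inj₂ refl) with suc d ≟ t
... | yes refl = ⊥-elim (<-irrefl refl lt)
... | no _ = inj₂ refl
Adjacent⇒pred-or-succ cycle t c .(suc c) _ (inj₁ refl) = inj₁ refl
Adjacent⇒pred-or-succ cycle t .(suc d) d lt (inj₂ (inj₁ refl)) with suc d ≟ t
... | yes refl = ⊥-elim (<-irrefl refl lt)
... | no _ = inj₂ refl
Adjacent⇒pred-or-succ cycle t .0 d _ (inj₂ (inj₂ (inj₁ (refl , e)))) with suc d ≟ t
... | yes _ = inj₂ refl
... | no ne = ⊥-elim (ne e)
Adjacent⇒pred-or-succ cycle .(suc c) c .0 _ (inj₂ (inj₂ (inj₂ (refl , refl)))) = inj₁ refl

degree≤2 : ∀ k t d → ∑[ c < t ] 𝟙 (Adjacent? k t c d) ≤ 2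
degree≤2 k t d = begin
  ∑[ c < t ] 𝟙 (Adjacent? k t c d)                                        ≤⟨ ∑-mono-≤ t two-candidates ⟩
  ∑[ c < t ] (𝟙 (c ≟ predecessor t d) + 𝟙 (c ≟ successor t d))            ≡⟨ ∑-distrib-+ t _ _ ⟩
  ∑[ c < t ] 𝟙 (c ≟ predecessor t d) + ∑[ c < t ] 𝟙 (c ≟ successor t d)  ≤⟨ +-mono-≤ (∑-𝟙-≡-≤1 t _) (∑-𝟙-≡-≤1 t _) ⟩
  2                                                                       ∎
  where
  open ≤-Reasoning
  two-candidates : ∀ c → c < t → 𝟙 (Adjacent? k t c d) ≤ 𝟙 (c ≟ predecessor t d) + 𝟙 (c ≟ successor t d)
  two-candidates c c<t = 𝟙-⊎ (Adjacent? k t c d) (c ≟ predecessor t d) (c ≟ successor t d) (Adjacent⇒pred-or-succ k t c d c<t)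

degree≤2′ : ∀ k t c → ∑[ d < t ] 𝟙 (Adjacent? k t c d) ≤ 2
degree≤2′ k t c = ≤-trans (∑-mono-≤ t (λ d _ → 𝟙-mono (Adjacent? k t c d) (Adjacent? k t d c) (Adjacent-sym k t c d))) (degree≤2 k t c)

isEven : ℕ → Bool
isEven zero = true
isEven (suc zero) = false
isEven (suc (suc n)) = isEven n

isEven-suc : ∀ n → isEven (suc n) ≡ not (isEven n)
isEven-suc zero = refl
isEven-suc (suc zero) = refl
isEven-suc (suc (suc n)) = isEven-suc n

Bipartite : Kind → ℕ → Set
Bipartite k t = k ≡ cycle → isEven t ≡ true

Adjacent-parity : ∀ k t c d → Bipartite k t → Adjacent k t c d → isEven c ≡ not (isEven d)
Adjacent-parity path t c .(suc c) _ (inj₁ refl) = flip (isEven-suc c)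
  where flip : ∀ {a b} → b ≡ not a → a ≡ not b
        flip {true} refl = refl
        flip {false} refl = refl
Adjacent-parity path t .(suc d) d _ (inj₂ refl) = isEven-suc d
Adjacent-parity cycle t c .(suc c) _ (inj₁ refl) = Adjacent-parity path t c (suc c) (λ ()) (inj₁ refl)
Adjacent-parity cycle t .(suc d) d _ (inj₂ (inj₁ refl)) = isEven-suc d
Adjacent-parity cycle .(suc d) .0 d bip (inj₂ (inj₂ (inj₁ (refl , refl)))) = sym (trans (sym (isEven-suc d)) (bip refl))
Adjacent-parity cycle .(suc c) c .0 bip (inj₂ (inj₂ (inj₂ (refl , refl)))) = odd (trans (sym (isEven-suc c)) (bip refl))
  where odd : ∀ {b} → not b ≡ true → b ≡ false
        odd {false} _ = refl

-- Covering columns by load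

all-or-counterexample : {P : ℕ → Set} → (∀ i → Dec (P i)) → ∀ t → (∀ i → i < t → P i) ⊎ (∃ λ i → i < t × ¬ P i)
all-or-counterexample P? t with anyUpTo? (¬? ∘ P?) t
... | yes counterexample = inj₂ counterexample
... | no none = inj₁ λ i lt → decidable-stable (P? i) (λ ¬p → none (i , lt , ¬p))

Covered : Kind → ℕ → (ℕ → ℕ) → ℕ → Set
Covered k t f i = ∃ λ d → d < t × Adjacent k t d i × 1 ≤ f d

Covered? : ∀ k t f i → Dec (Covered k t f i)
Covered? k t f i = anyUpTo? (λ d → Adjacent? k t d i ×-dec (1 ≤? f d)) t

-- Each column of positive load is adjacent to at most two columns.
covered-count≤ : ∀ k t {X : ℕ → Set} (X? : ∀ i → Dec (X i)) (f : ℕ → ℕ) →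
  (∀ i → i < t → X i → Covered k t f i) → ∑[ i < t ] 𝟙 (X? i) ≤ 2 * sumBelow t f
covered-count≤ k t X? f cover = begin
  ∑[ i < t ] 𝟙 (X? i)                                 ≤⟨ ∑-mono-≤ t counted ⟩
  ∑[ i < t ] ∑[ d < t ] (𝟙 (Adjacent? k t d i) * f d) ≡⟨ ∑-swap t t (λ i d → 𝟙 (Adjacent? k t d i) * f d) ⟩
  ∑[ d < t ] ∑[ i < t ] (𝟙 (Adjacent? k t d i) * f d) ≡⟨ ∑-cong t (λ d _ → factor d) ⟩
  ∑[ d < t ] (f d * ∑[ i < t ] 𝟙 (Adjacent? k t d i)) ≤⟨ ∑-mono-≤ t (λ d _ → *-monoʳ-≤ (f d) (degree≤2′ k t d)) ⟩
  ∑[ d < t ] (f d * 2)                                 ≡⟨ ∑-cong t (λ d _ → *-comm (f d) 2) ⟩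
  ∑[ d < t ] (2 * f d)                                 ≡⟨ ∑-*ˡ t 2 f ⟩
  2 * sumBelow t f                                     ∎
  where
  open ≤-Reasoning
  factor : ∀ d → ∑[ i < t ] (𝟙 (Adjacent? k t d i) * f d) ≡ f d * ∑[ i < t ] 𝟙 (Adjacent? k t d i)
  factor d = trans (∑-cong t (λ i _ → *-comm (𝟙 (Adjacent? k t d i)) (f d))) (∑-*ˡ t (f d) (λ i → 𝟙 (Adjacent? k t d i)))
  counted : ∀ i → i < t → 𝟙 (X? i) ≤ ∑[ d < t ] (𝟙 (Adjacent? k t d i) * f d)
  counted i lt with X? i
  ... | no _ = z≤n
  ... | yes x with cover i lt x
  ... | d , d<t , a , fd>0 = ≤-trans (subst (λ z → 1 ≤ z * f d) (sym (𝟙-yes (Adjacent? k t d i) a)) (subst (1 ≤_) (sym (+-identityʳ (f d))) fd>0))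
                                     (term≤∑ t (λ d → 𝟙 (Adjacent? k t d i) * f d) d d<t)

all-covered⇒t≤2∑ : ∀ k t f → (∀ i → i < t → Covered k t f i) → t ≤ 2 * sumBelow t f
all-covered⇒t≤2∑ k t f cover =
  subst (_≤ 2 * sumBelow t f) (trans (∑-const t 1) (*-identityʳ t))
        (covered-count≤ k t (λ _ → yes tt) f (λ i lt _ → cover i lt))

ofParity : Bool → (ℕ → ℕ) → ℕ → ℕ
ofParity b f d = 𝟙 (isEven d Bool.≟ b) * f d

∑-ofParity : ∀ t f → sumBelow t (ofParity true f) + sumBelow t (ofParity false f) ≡ sumBelow t f
∑-ofParity t f = trans (sym (∑-distrib-+ t (ofParity true f) (ofParity false f))) (∑-cong t (λ d _ → split d))
  where
  one-of : ∀ x → 𝟙 (x Bool.≟ true) + 𝟙 (x Bool.≟ false) ≡ 1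
  one-of true = refl
  one-of false = refl
  split : ∀ d → ofParity true f d + ofParity false f d ≡ f d
  split d = trans (sym (*-distribʳ-+ (f d) (𝟙 (isEven d Bool.≟ true)) _))
                  (trans (cong (_* f d) (one-of (isEven d))) (*-identityˡ (f d)))

parity-class-count≤ : ∀ k t f b → Bipartite k t → (∀ i → i < t → Covered k t f i) →
  ∑[ i < t ] 𝟙 (isEven i Bool.≟ b) ≤ 2 * sumBelow t (ofParity (not b) f)
parity-class-count≤ k t f b bip cover = covered-count≤ k t (λ i → isEven i Bool.≟ b) (ofParity (not b) f) cover′
  where
  cover′ : ∀ i → i < t → isEven i ≡ b → Covered k t (ofParity (not b) f) i
  cover′ i lt refl with cover i lt
  ... | d , d<t , a , fd>0 = d , d<t , a , positive
    where
    positive : 1 ≤ ofParity (not (isEven i)) f d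
    positive rewrite 𝟙-yes (isEven d Bool.≟ not (isEven i)) (Adjacent-parity k t d i bip a) | +-identityʳ (f d) = fd>0

isEven-double : ∀ h → isEven (h + h) ≡ true
isEven-double zero = refl
isEven-double (suc h) rewrite +-suc h h = isEven-double h

parity-class-size : ∀ h b → ∑[ i < h + h ] 𝟙 (isEven i Bool.≟ b) ≡ h
parity-class-size zero b = refl
parity-class-size (suc h) b rewrite +-suc h h | isEven-suc (h + h) | isEven-double h | parity-class-size h b =
  trans (+-assoc h _ _) (trans (cong (h +_) (one-of b)) (+-comm h 1))
  where
  one-of : ∀ b → 𝟙 (true Bool.≟ b) + 𝟙 (false Bool.≟ b) ≡ 1
  one-of true = refl
  one-of false = refl

Far : Kind → ℕ → ℕ → ℕ → Set
Far k t i j = ¬ Adjacent k t j i × j ≢ i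

Far? : ∀ k t i j → Dec (Far k t i j)
Far? k t i j = ¬? (Adjacent? k t j i) ×-dec ¬? (j ≟ i)

far-count : ∀ k t i → t ≤ ∑[ j < t ] 𝟙 (Far? k t i j) + 3
far-count k t i = begin
  t                                                                     ≡⟨ sym (trans (∑-const t 1) (*-identityʳ t)) ⟩
  ∑[ j < t ] 1                                                          ≤⟨ ∑-mono-≤ t (λ j _ → trichotomy j) ⟩
  ∑[ j < t ] (𝟙 (Far? k t i j) + (𝟙 (Adjacent? k t j i) + 𝟙 (j ≟ i)))  ≡⟨ ∑-distrib-+ t _ _ ⟩
  Nfar + ∑[ j < t ] (𝟙 (Adjacent? k t j i) + 𝟙 (j ≟ i))                ≡⟨ cong (Nfar +_) (∑-distrib-+ t _ _) ⟩
  Nfar + (∑[ j < t ] 𝟙 (Adjacent? k t j i) + ∑[ j < t ] 𝟙 (j ≟ i))     ≤⟨ +-monoʳ-≤ Nfar (+-mono-≤ (degree≤2 k t i) (∑-𝟙-≡-≤1 t i)) ⟩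
  Nfar + 3                                                              ∎
  where
  open ≤-Reasoning
  Nfar = ∑[ j < t ] 𝟙 (Far? k t i j)
  trichotomy : ∀ j → 1 ≤ 𝟙 (Far? k t i j) + (𝟙 (Adjacent? k t j i) + 𝟙 (j ≟ i))
  trichotomy j with Far? k t i j
  ... | yes _ = s≤s z≤n
  ... | no ¬far with Adjacent? k t j i
  ...   | yes _ = s≤s z≤n
  ...   | no ¬adj with j ≟ i
  ...     | yes _ = s≤s z≤n
  ...     | no j≢i = ⊥-elim (¬far (¬adj , j≢i))

-- The columns far from i are either covered without the help of column i, or one of them is
-- itself uncovered and carries a load of at least m.
uncovered-column : ∀ k t f m i → i < t → (∀ j → j < t → Covered k t f j ⊎ m ≤ f j) →
  f i + m ≤ sumBelow t f ⊎ t ≤ 2 * sumBelow t (erase i f) + 3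
uncovered-column k t f m i i<t condition with all-or-counterexample (λ j → Far? k t i j →-dec Covered? k t f j) t
... | inj₂ (j , j<t , uncovered) = inj₁ (≤-trans (+-monoʳ-≤ (f i) heavy) (two-terms≤∑ t f i j i<t j<t (λ e → proj₂ far (sym e))))
  where
  far : Far k t i j
  far = decidable-stable (Far? k t i j) (λ ¬far → uncovered (λ far → ⊥-elim (¬far far)))
  heavy : m ≤ f j
  heavy with condition j j<t
  ... | inj₂ q = q
  ... | inj₁ c = ⊥-elim (uncovered (λ _ → c))
... | inj₁ far⇒covered = inj₂ (≤-trans (far-count k t i) (+-monoˡ-≤ 3 (covered-count≤ k t (Far? k t i) (erase i f) cover)))
  where
  cover : ∀ j → j < t → Far k t i j → Covered k t (erase i f) j
  cover j j<t far with far⇒covered j j<t far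
  ... | d , d<t , a , fd>0 = d , d<t , a , positive
    where
    positive : 1 ≤ erase i f d
    positive with d ≟ i
    ... | yes refl = ⊥-elim (proj₁ far (Adjacent-sym k t d j a))
    ... | no _ = fd>0

-- The consequences for the total load F of every column being covered or of load at least m.
data LoadBound (k : Kind) (t m F : ℕ) : Set where
  all-covered : t ≤ 2 * F →
                (Bipartite k t → ∀ h → t ≡ h + h → ∃ λ a → ∃ λ b → h ≤ 2 * a × h ≤ 2 * b × a + b ≡ F) →
                LoadBound k t m F
  two-heavy   : m + m ≤ F → LoadBound k t m F
  one-heavy   : t + (m + m) ≤ 2 * F + 3 → LoadBound k t m F

column-condition⇒LoadBound : ∀ k t m f → (∀ j → j < t → Covered k t f j ⊎ m ≤ f j) → LoadBound k t m (sumBelow t f)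
column-condition⇒LoadBound k t m f condition with all-or-counterexample (Covered? k t f) t
... | inj₁ cover = all-covered (all-covered⇒t≤2∑ k t f cover) parity-classes
  where
  parity-classes : Bipartite k t → ∀ h → t ≡ h + h → ∃ λ a → ∃ λ b → h ≤ 2 * a × h ≤ 2 * b × a + b ≡ sumBelow t f
  parity-classes bip h refl = sumBelow t (ofParity true f) , sumBelow t (ofParity false f) ,
    subst (_≤ 2 * sumBelow t (ofParity true f)) (parity-class-size h false) (parity-class-count≤ k t f false bip cover) ,
    subst (_≤ 2 * sumBelow t (ofParity false f)) (parity-class-size h true) (parity-class-count≤ k t f true bip cover) ,
    ∑-ofParity t f
... | inj₂ (i , i<t , uncovered) with heavy | uncovered-column k t f m i i<t condition
  where
  heavy : m ≤ f i
  heavy with condition i i<t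
  ... | inj₁ c = ⊥-elim (uncovered c)
  ... | inj₂ q = q
... | m≤fi | inj₁ p = two-heavy (≤-trans (+-monoˡ-≤ m m≤fi) p)
... | m≤fi | inj₂ p = one-heavy (begin
  t + (m + m)                  ≤⟨ +-mono-≤ p (+-mono-≤ m≤fi m≤fi) ⟩
  (2 * E + 3) + (f i + f i)    ≡⟨ regroup E (f i) ⟩
  2 * (E + f i) + 3            ≡⟨ cong (λ s → 2 * s + 3) (∑-erase t f i i<t) ⟩
  2 * sumBelow t f + 3         ∎)
  where
  open ≤-Reasoning
  E = sumBelow t (erase i f)
  regroup : ∀ e x → (2 * e + 3) + (x + x) ≡ 2 * (e + x) + 3
  regroup = solve-∀

double-≤ : ∀ a b → a + a ≤ suc (b + b) → a ≤ b
double-≤ zero b _ = z≤n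
double-≤ (suc a) zero p rewrite +-suc a a = ⊥-elim (too-big p)
  where too-big : ∀ {x} → suc (suc x) ≤ 1 → ⊥
        too-big (s≤s ())
double-≤ (suc a) (suc b) p rewrite +-suc a a | +-suc b b = s≤s (double-≤ a b (≤-pred (≤-pred p)))

2*≡+ : ∀ a → 2 * a ≡ a + a
2*≡+ a = cong (a +_) (+-identityʳ a)

heavy⇒≥ : ∀ {m F} t T → T ≤ m + m → T + T + 2 ≤ m + m + t → m + m ≤ F ⊎ t + (m + m) ≤ 2 * F + 3 → T ≤ F
heavy⇒≥ t T T≤2m _ (inj₁ 2m≤F) = ≤-trans T≤2m 2m≤F
heavy⇒≥ {m} {F} t T _ tight (inj₂ spread) = double-≤ T F (+-cancelʳ-≤ 2 (T + T) _ (begin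
  T + T + 2        ≤⟨ tight ⟩
  m + m + t        ≡⟨ +-comm (m + m) t ⟩
  t + (m + m)      ≤⟨ spread ⟩
  2 * F + 3        ≡⟨ cong (_+ 3) (2*≡+ F) ⟩
  F + F + 3        ≡⟨ +-suc (F + F) 2 ⟩
  suc (F + F) + 2  ∎))
  where open ≤-Reasoning

LoadBound⇒≥ : ∀ {k t m F} T → T + T ≤ suc t → T ≤ m + m → T + T + 2 ≤ m + m + t → LoadBound k t m F → T ≤ F
LoadBound⇒≥ {t = t} {F = F} T small _ _ (all-covered t≤2F _) =
  double-≤ T F (≤-trans small (s≤s (subst (t ≤_) (2*≡+ F) t≤2F)))
LoadBound⇒≥ {t = t} {m} T _ T≤2m tight (two-heavy p) = heavy⇒≥ {m} t T T≤2m tight (inj₁ p)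
LoadBound⇒≥ {t = t} {m} T _ T≤2m tight (one-heavy p) = heavy⇒≥ {m} t T T≤2m tight (inj₂ p)

-- For t ≡ 2 (mod 4) both parity classes have odd size, which forces one extra unit of load.
LoadBound⇒≥-bipartite : ∀ {k m F} p → Bipartite k (2 + p * 4) → 2 + p * 2 ≤ m + m →
  (2 + p * 2) + (2 + p * 2) + 2 ≤ m + m + (2 + p * 4) → LoadBound k (2 + p * 4) m F → 2 + p * 2 ≤ F
LoadBound⇒≥-bipartite p bip _ _ (all-covered _ classes) with classes bip (1 + p * 2) (halves p)
  where
  halves : ∀ p → 2 + p * 4 ≡ (1 + p * 2) + (1 + p * 2)
  halves = solve-∀
... | a , b , h≤2a , h≤2b , refl = subst (_≤ a + b) (sym (two-halves p)) (+-mono-≤ (more-than-half {a} h≤2a) (more-than-half {b} h≤2b))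
  where
  two-halves : ∀ p → 2 + p * 2 ≡ suc p + suc p
  two-halves = solve-∀
  more-than-half : ∀ {a} → 1 + p * 2 ≤ 2 * a → suc p ≤ a
  more-than-half {a} h≤2a = double-≤ (suc p) a (subst₂ _≤_ (two-halves p) (cong suc (2*≡+ a)) (s≤s h≤2a))
LoadBound⇒≥-bipartite {m = m} p _ T≤2m tight (two-heavy q) = heavy⇒≥ {m} (2 + p * 4) _ T≤2m tight (inj₁ q)
LoadBound⇒≥-bipartite {m = m} p _ T≤2m tight (one-heavy q) = heavy⇒≥ {m} (2 + p * 4) _ T≤2m tight (inj₂ q)

-- The load of a power dominating set

module _ {t n : ℕ} where

  open import Data.List.Membership.DecPropositional {A = Fin t × Fin n} (≡-dec Fin._≟_ Fin._≟_) using (_∈?_)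

  Hits : Fin t × Fin n → ℕ → ℕ → Set
  Hits s c z = c ≡ toℕ (proj₁ s) × z ≡ toℕ (proj₂ s)

  Hits? : ∀ s c z → Dec (Hits s c z)
  Hits? s c z = (c ≟ toℕ (proj₁ s)) ×-dec (z ≟ toℕ (proj₂ s))

  load : List (Fin t × Fin n) → ℕ → ℕ
  load S c = ∑[ z < n ] 𝟙 (Any.any? (λ s → Hits? s c z) S)

  ∑-Hits≤1 : ∀ s → ∑[ c < t ] ∑[ z < n ] 𝟙 (Hits? s c z) ≤ 1
  ∑-Hits≤1 s = begin
    ∑[ c < t ] ∑[ z < n ] 𝟙 (Hits? s c z)           ≤⟨ ∑-mono-≤ t (λ c _ → ∑-mono-≤ n (λ z _ → product c z)) ⟩
    ∑[ c < t ] ∑[ z < n ] (𝟙 (c ≟ a) * 𝟙 (z ≟ b))   ≡⟨ ∑-cong t (λ c _ → ∑-*ˡ n (𝟙 (c ≟ a)) (λ z → 𝟙 (z ≟ b))) ⟩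
    ∑[ c < t ] (𝟙 (c ≟ a) * ∑[ z < n ] 𝟙 (z ≟ b))   ≤⟨ ∑-mono-≤ t (λ c _ → *-monoʳ-≤ (𝟙 (c ≟ a)) (∑-𝟙-≡-≤1 n b)) ⟩
    ∑[ c < t ] (𝟙 (c ≟ a) * 1)                       ≡⟨ ∑-cong t (λ c _ → *-identityʳ (𝟙 (c ≟ a))) ⟩
    ∑[ c < t ] 𝟙 (c ≟ a)                             ≤⟨ ∑-𝟙-≡-≤1 t a ⟩
    1                                                ∎
    where
    open ≤-Reasoning
    a = toℕ (proj₁ s)
    b = toℕ (proj₂ s)
    product : ∀ c z → 𝟙 (Hits? s c z) ≤ 𝟙 (c ≟ a) * 𝟙 (z ≟ b)
    product c z with c ≟ a | z ≟ b
    ... | yes _ | yes _ = s≤s z≤n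
    ... | yes _ | no _ = z≤n
    ... | no _ | _ = z≤n

  ∑-load≤length : ∀ S → sumBelow t (load S) ≤ length S
  ∑-load≤length [] = ≤-reflexive (trans (∑-cong t (λ _ _ → trans (∑-const n 0) (*-zeroʳ n))) (trans (∑-const t 0) (*-zeroʳ t)))
  ∑-load≤length (s ∷ S) = begin
    sumBelow t (load (s ∷ S))                                              ≤⟨ ∑-mono-≤ t (λ c _ → ∑-mono-≤ n (λ z _ → head-or-tail c z)) ⟩
    ∑[ c < t ] ∑[ z < n ] (𝟙 (Hits? s c z) + 𝟙 (Any.any? (λ s → Hits? s c z) S)) ≡⟨ ∑-cong t (λ c _ → ∑-distrib-+ n _ _) ⟩
    ∑[ c < t ] (∑[ z < n ] 𝟙 (Hits? s c z) + load S c)                     ≡⟨ ∑-distrib-+ t _ _ ⟩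
    ∑[ c < t ] ∑[ z < n ] 𝟙 (Hits? s c z) + sumBelow t (load S)            ≤⟨ +-mono-≤ (∑-Hits≤1 s) (∑-load≤length S) ⟩
    suc (length S)                                                         ∎
    where
    open ≤-Reasoning
    head-or-tail : ∀ c z → 𝟙 (Any.any? (λ s → Hits? s c z) (s ∷ S)) ≤ 𝟙 (Hits? s c z) + 𝟙 (Any.any? (λ s → Hits? s c z) S)
    head-or-tail c z = 𝟙-⊎ (Any.any? (λ s → Hits? s c z) (s ∷ S)) (Hits? s c z) (Any.any? (λ s → Hits? s c z) S) Any.toSum

  load-positive : ∀ S v → v ∈ S → 1 ≤ load S (toℕ (proj₁ v))
  load-positive S v v∈S = ≤-trans (≤-reflexive (sym (𝟙-yes (Any.any? _ S) (Any.map (λ { refl → refl , refl }) v∈S))))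
                                  (term≤∑ n _ (toℕ (proj₂ v)) (toℕ<n (proj₂ v)))

  full-column⇒load≥ : ∀ S (i : Fin t) (c y : Fin n) → (∀ z → z ≢ c → z ≢ y → (i , z) ∈ S) → n ∸ 2 ≤ load S (toℕ i)
  full-column⇒load≥ S i c y full = m≤n+o⇒m∸o≤n (begin
    n                                                           ≡⟨ sym (trans (∑-const n 1) (*-identityʳ n)) ⟩
    ∑[ z < n ] 1                                                ≤⟨ ∑-mono-≤ n member-or-excluded ⟩
    ∑[ z < n ] (𝟙 (hit z) + (𝟙 (z ≟ toℕ c) + 𝟙 (z ≟ toℕ y)))   ≡⟨ ∑-distrib-+ n _ _ ⟩
    L + ∑[ z < n ] (𝟙 (z ≟ toℕ c) + 𝟙 (z ≟ toℕ y))              ≡⟨ cong (L +_) (∑-distrib-+ n _ _) ⟩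
    L + (∑[ z < n ] 𝟙 (z ≟ toℕ c) + ∑[ z < n ] 𝟙 (z ≟ toℕ y))   ≤⟨ +-monoʳ-≤ L (+-mono-≤ (∑-𝟙-≡-≤1 n (toℕ c)) (∑-𝟙-≡-≤1 n (toℕ y))) ⟩
    L + 2                                                       ∎)
    where
    open ≤-Reasoning
    L = load S (toℕ i)
    hit : ∀ z → Dec (Any (λ s → Hits s (toℕ i) z) S)
    hit z = Any.any? (λ s → Hits? s (toℕ i) z) S
    m≤n+o⇒m∸o≤n : ∀ {m a} → m ≤ a + 2 → m ∸ 2 ≤ a
    m≤n+o⇒m∸o≤n {m} {a} p = subst (m ∸ 2 ≤_) (m+n∸n≡m a 2) (∸-monoˡ-≤ 2 p)
    other : ∀ {z x} (z<n : z < n) → z ≢ toℕ x → fromℕ< z<n ≢ x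
    other z<n z≢x e = z≢x (trans (sym (toℕ-fromℕ< z<n)) (cong toℕ e))
    member-or-excluded : ∀ z → z < n → 1 ≤ 𝟙 (hit z) + (𝟙 (z ≟ toℕ c) + 𝟙 (z ≟ toℕ y))
    member-or-excluded z z<n with z ≟ toℕ c
    ... | yes _ = ≤-trans (s≤s z≤n) (m≤n+m (suc (𝟙 (z ≟ toℕ y))) (𝟙 (hit z)))
    ... | no z≢c with z ≟ toℕ y
    ...   | yes _ = m≤n+m 1 (𝟙 (hit z))
    ...   | no z≢y rewrite 𝟙-yes (hit z) (Any.map (λ { refl → refl , sym (toℕ-fromℕ< z<n) }) (full (fromℕ< z<n) (other z<n z≢c) (other z<n z≢y))) = s≤s z≤n

  Sparse : List (Fin t × Fin n) → Fin t → Set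
  Sparse S i = ∀ c y → ∃ λ z → z ≢ c × z ≢ y × (i , z) ∉ S

  Sparse? : ∀ S i → Dec (Sparse S i)
  Sparse? S i = Fin.all? λ c → Fin.all? λ y → Fin.any? λ z → ¬? (z Fin.≟ c) ×-dec ¬? (z Fin.≟ y) ×-dec ¬? ((i , z) ∈? S)

  ¬Sparse⇒full : ∀ S i → ¬ Sparse S i → ∃ λ c → ∃ λ y → ∀ z → z ≢ c → z ≢ y → (i , z) ∈ S
  ¬Sparse⇒full S i ¬sparse with ¬∀⟶∃¬ n _ (λ c → Fin.all? λ y → Fin.any? λ z → ¬? (z Fin.≟ c) ×-dec ¬? (z Fin.≟ y) ×-dec ¬? ((i , z) ∈? S)) ¬sparse
  ... | c , ¬∀y with ¬∀⟶∃¬ n _ (λ y → Fin.any? λ z → ¬? (z Fin.≟ c) ×-dec ¬? (z Fin.≟ y) ×-dec ¬? ((i , z) ∈? S)) ¬∀y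
  ... | y , ¬∃z = c , y , λ z z≢c z≢y → decidable-stable ((i , z) ∈? S) (λ z∉S → ¬∃z (z , z≢c , z≢y , z∉S))

  -- In a sparse column every vertex has, besides the one being forced, a second neighbour
  -- in that column outside S, so nothing can be forced into it.
  sparse-column-unobservable : ∀ {k} S i → ¬ Any (λ s → Adjacent k t (toℕ (proj₁ s)) (toℕ i)) S → Sparse S i →
    ∀ v → Observed (Board k t n) S v → proj₁ v ≢ i ⊎ v ∈ S
  sparse-column-unobservable S i _ _ v (dom-self v∈S) = inj₂ v∈S
  sparse-column-unobservable {k} S i ¬adj _ v (dom-nbr {u} u∈S (a , _)) =
    inj₁ λ { refl → ¬adj (Any.map (λ { refl → a }) u∈S) }
  sparse-column-unobservable S i ¬adj sparse w (propagate {u} obs-u (a , _) rest) with proj₁ w Fin.≟ i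
  ... | no w∉i = inj₁ w∉i
  ... | yes refl with sparse (proj₂ u) (proj₂ w)
  ... | z , z≢u , z≢w , z∉S with sparse-column-unobservable S i ¬adj sparse (i , z) (rest (i , z) (a , λ e → z≢u (sym e)) (λ e → z≢w (cong proj₂ e)))
  ... | inj₁ i≢i = ⊥-elim (i≢i refl)
  ... | inj₂ z∈S = ⊥-elim (z∉S z∈S)

column-condition : ∀ k t n (S : List (Fin t × Fin n)) → (∀ v → Observed (Board k t n) S v) → (i : Fin t) →
  Covered k t (load S) (toℕ i) ⊎ n ∸ 2 ≤ load S (toℕ i)
column-condition k t zero S _ i = inj₂ z≤n
column-condition k t (suc n) S observed i with Any.any? (λ s → Adjacent? k t (toℕ (proj₁ s)) (toℕ i)) S
... | yes adj with find adj
... | s , s∈S , a = inj₁ (toℕ (proj₁ s) , toℕ<n (proj₁ s) , a , load-positive S s s∈S)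
column-condition k t (suc n) S observed i | no ¬adj with Sparse? S i
... | no ¬sparse with ¬Sparse⇒full S i ¬sparse
... | c , y , full = inj₂ (full-column⇒load≥ S i c y full)
column-condition k t (suc n) S observed i | no ¬adj | yes sparse with sparse fz fz
... | z , _ , _ , z∉S with sparse-column-unobservable S i ¬adj sparse (i , z) (observed (i , z))
... | inj₁ i≢i = ⊥-elim (i≢i refl)
... | inj₂ z∈S = ⊥-elim (z∉S z∈S)

pd-lower-bound : ∀ k t n T → (∀ F → LoadBound k t (n ∸ 2) F → T ≤ F) →
  ∀ S → IsPowerDominating (Board k t n) S → T ≤ length S
pd-lower-bound k t n T bound S (_ , observed) =
  ≤-trans (bound _ (column-condition⇒LoadBound k t (n ∸ 2) (load S) condition)) (∑-load≤length S)
  where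
  condition : ∀ j → j < t → Covered k t (load S) j ⊎ n ∸ 2 ≤ load S j
  condition j j<t = subst (λ c → Covered k t (load S) c ⊎ n ∸ 2 ≤ load S c) (toℕ-fromℕ< j<t)
                          (column-condition k t n S observed (fromℕ< j<t))

-- A power dominating set in row 0

-- Columns are given as naturals; out-of-range values are sent to column 0 but never occur.
toColumn : ∀ t′ → ℕ → Fin (suc t′)
toColumn t′ d with d <? suc t′
... | yes d<t = fromℕ< d<t
... | no _ = fz

toℕ-toColumn : ∀ t′ d → d < suc t′ → toℕ (toColumn t′ d) ≡ d
toℕ-toColumn t′ d d<t with d <? suc t′
... | yes p = toℕ-fromℕ< p
... | no d≮t = ⊥-elim (d≮t d<t)

record ColumnPlan (t : ℕ) : Set where
  field
    columns  : List ℕ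
    bounded  : All (_< t) columns
    distinct : Unique columns
    covering : ∀ i → i < t → ∃ λ d → d ∈ columns × Adjacent path t d i
    1∈       : 1 ∈ columns
    2∈       : 2 ∈ columns

open ColumnPlan

row0 : ∀ t′ n′ → List ℕ → List (Fin (suc t′) × Fin (suc n′))
row0 t′ n′ = map (λ d → toColumn t′ d , fz)

row0-distinct : ∀ t′ n′ (D : List ℕ) → All (_< suc t′) D → Unique D → Unique (row0 t′ n′ D)
row0-distinct t′ n′ [] _ _ = []
row0-distinct t′ n′ (x ∷ xs) (x<t ∷ xs<t) (x∉xs ∷ distinct) = fresh xs xs<t x∉xs ∷ row0-distinct t′ n′ xs xs<t distinct
  where
  fresh : ∀ ys → All (_< suc t′) ys → All (x ≢_) ys → All ((toColumn t′ x , fz) ≢_) (row0 t′ n′ ys)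
  fresh [] _ _ = []
  fresh (y ∷ ys) (y<t ∷ ys<t) (x≢y ∷ x∉ys) =
    (λ e → x≢y (trans (sym (toℕ-toColumn t′ x x<t)) (trans (cong (toℕ ∘ proj₁) e) (toℕ-toColumn t′ y y<t)))) ∷ fresh ys ys<t x∉ys

inner-neighbour : ∀ k t j x → suc (suc j) < t → Adjacent k t (suc j) x → x ≡ j ⊎ x ≡ suc (suc j)
inner-neighbour path t j x _ (inj₁ e) = inj₂ (sym e)
inner-neighbour path t j x _ (inj₂ e) = inj₁ (suc-injective e)
inner-neighbour cycle t j x _ (inj₁ e) = inj₂ (sym e)
inner-neighbour cycle t j x _ (inj₂ (inj₁ e)) = inj₁ (suc-injective e)
inner-neighbour cycle t j x _ (inj₂ (inj₂ (inj₁ (() , _))))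
inner-neighbour cycle t j x lt (inj₂ (inj₂ (inj₂ (_ , e)))) = ⊥-elim (<-irrefl e lt)

-- Rows other than 0 are dominated by the plan; row 0 is then forced column by column from
-- columns 1 and 2, each forcing step using the vertex in row 1 of the column in between.
module Forcing (k : Kind) (t′ n′ : ℕ) (P : ColumnPlan (suc t′)) where

  t = suc t′
  n = suc (suc n′)
  S = row0 t′ (suc n′) (columns P)
  Obs = Observed (Board k t n) S

  D<t : ∀ {d} → d ∈ columns P → d < t
  D<t = All.lookup (bounded P)

  off-row0 : ∀ (c : Fin t) z → z ≢ fz → Obs (c , z)
  off-row0 c z z≢0 with covering P (toℕ c) (toℕ<n c)
  ... | d , d∈ , a = dom-nbr (∈-map⁺ _ d∈)
        (subst (λ e → Adjacent k t e (toℕ c)) (sym (toℕ-toColumn t′ d (D<t d∈))) (path⇒Adjacent k t d (toℕ c) a) , λ e → z≢0 (sym e))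

  in-plan : ∀ d (c : Fin t) → d ∈ columns P → toℕ c ≡ d → Obs (c , fz)
  in-plan d c d∈ e = subst (λ c′ → Obs (c′ , fz)) (toℕ-injective (trans (toℕ-toColumn t′ d (D<t d∈)) (sym e)))
                       (dom-self (∈-map⁺ _ d∈))

  Across : ℕ → Fin t → Fin t → Set
  Across j a b = (toℕ a ≡ j × toℕ b ≡ suc (suc j)) ⊎ (toℕ a ≡ suc (suc j) × toℕ b ≡ j)

  forced-across : ∀ j (a b : Fin t) → suc (suc j) < t → Across j a b → Obs (a , fz) → Obs (b , fz)
  forced-across j a b lt ab obs-a = propagate (off-row0 middle one λ ()) (toward-b ab) (others ab)
    where
    one : Fin n
    one = fs fz
    middle : Fin t
    middle = fromℕ< (<-trans (n<1+n (suc j)) lt)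
    toℕ-middle : toℕ middle ≡ suc j
    toℕ-middle = toℕ-fromℕ< (<-trans (n<1+n (suc j)) lt)
    toward-b : Across j a b → Adjacent k t (toℕ middle) (toℕ b) × one ≢ fz
    toward-b (inj₁ (_ , eb)) rewrite toℕ-middle | eb = path⇒Adjacent k t (suc j) (suc (suc j)) (inj₁ refl) , λ ()
    toward-b (inj₂ (_ , eb)) rewrite toℕ-middle | eb = path⇒Adjacent k t (suc j) j (inj₂ refl) , λ ()
    others : Across j a b → ∀ x → Adjacent k t (toℕ middle) (toℕ (proj₁ x)) × one ≢ proj₂ x → x ≢ (b , fz) → Obs x
    others ab (xc , xz) (ax , _) x≢b with xz Fin.≟ fz
    ... | no xz≢0 = off-row0 xc xz xz≢0
    ... | yes refl with inner-neighbour k t j (toℕ xc) lt (subst (λ e → Adjacent k t e (toℕ xc)) toℕ-middle ax) | ab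
    ... | inj₁ e | inj₁ (ea , _) = subst (λ c′ → Obs (c′ , fz)) (toℕ-injective (trans ea (sym e))) obs-a
    ... | inj₁ e | inj₂ (_ , eb) = ⊥-elim (x≢b (cong (_, fz) (toℕ-injective (trans e (sym eb)))))
    ... | inj₂ e | inj₁ (_ , eb) = ⊥-elim (x≢b (cong (_, fz) (toℕ-injective (trans e (sym eb)))))
    ... | inj₂ e | inj₂ (ea , _) = subst (λ c′ → Obs (c′ , fz)) (toℕ-injective (trans ea (sym e))) obs-a

  Row0Observed : ℕ → Set
  Row0Observed j = ∀ (c : Fin t) → toℕ c ≡ j → Obs (c , fz)

  2<t : 2 < t
  2<t = D<t (2∈ P)

  column0 : Row0Observed 0
  column0 c e = forced-across 0 (fromℕ< 2<t) c 2<t (inj₂ (toℕ-fromℕ< 2<t , e)) (in-plan 2 (fromℕ< 2<t) (2∈ P) (toℕ-fromℕ< 2<t))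

  consecutive : ∀ j → (j < t → Row0Observed j) × (suc j < t → Row0Observed (suc j))
  consecutive zero = (λ _ → column0) , (λ _ c → in-plan 1 c (1∈ P))
  consecutive (suc j) = proj₂ (consecutive j) , λ lt c e →
    forced-across j (fromℕ< (j<t lt)) c lt (inj₁ (toℕ-fromℕ< _ , e)) (proj₁ (consecutive j) (j<t lt) _ (toℕ-fromℕ< _))
    where
    j<t : suc (suc j) < t → j < t
    j<t lt = <-trans (n<1+n j) (<-trans (n<1+n (suc j)) lt)

  all-observed : ∀ v → Obs v
  all-observed (c , z) with z Fin.≟ fz
  ... | yes refl = proj₁ (consecutive (toℕ c)) (toℕ<n c) c refl
  ... | no z≢0 = off-row0 c z z≢0

pd-upper-bound : ∀ k t′ n′ (P : ColumnPlan (suc t′)) →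
  Σ (List (Fin (suc t′) × Fin (suc (suc n′)))) λ S → IsPowerDominating (Board k (suc t′) (suc (suc n′))) S × length S ≡ length (columns P)
pd-upper-bound k t′ n′ P = row0 t′ (suc n′) (columns P) ,
  (row0-distinct t′ (suc n′) (columns P) (bounded P) (distinct P) , Forcing.all-observed k t′ n′ P) ,
  length-map _ (columns P)

blocks : ℕ → List ℕ
blocks zero = []
blocks (suc a) = (a * 4 + 2) ∷ (a * 4 + 1) ∷ blocks a

length-blocks : ∀ a → length (blocks a) ≡ a * 2
length-blocks zero = refl
length-blocks (suc a) = cong (suc ∘ suc) (length-blocks a)

blocks-bounded : ∀ a → All (λ x → x + 2 ≤ a * 4) (blocks a)
blocks-bounded zero = []
blocks-bounded (suc a) = last ∷ ≤-trans (≤-reflexive (+-assoc (a * 4) 1 2)) (≤-trans (+-monoʳ-≤ (a * 4) (n≤1+n 3)) (≤-reflexive (+-comm (a * 4) 4))) ∷ All.map (λ p → ≤-trans p (m≤n+m (a * 4) 4)) (blocks-bounded a)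
  where
  last : a * 4 + 2 + 2 ≤ 4 + a * 4
  last = ≤-reflexive (trans (+-assoc (a * 4) 2 2) (+-comm (a * 4) 4))

all-below⇒fresh : ∀ {x} {xs : List ℕ} → All (_< x) xs → All (x ≢_) xs
all-below⇒fresh = All.map (λ lt e → <-irrefl (sym e) lt)

blocks-distinct : ∀ a → Unique (blocks a)
blocks-distinct zero = []
blocks-distinct (suc a) =
  all-below⇒fresh (+-monoʳ-< (a * 4) (n<1+n 1) ∷ All.map (λ p → ≤-trans (below p) (+-monoʳ-≤ (a * 4) (n≤1+n 1))) (blocks-bounded a))
  ∷ all-below⇒fresh (All.map below (blocks-bounded a)) ∷ blocks-distinct a
  where
  below : ∀ {x} → x + 2 ≤ a * 4 → x < a * 4 + 1
  below {x} p = ≤-trans (subst (_≤ x + 2) (+-comm x 1) (+-monoʳ-≤ x (n≤1+n 1))) (≤-trans p (m≤m+n (a * 4) 1))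

1∈blocks : ∀ a → 1 ∈ blocks (suc a)
1∈blocks zero = there (here refl)
1∈blocks (suc a) = there (there (1∈blocks a))

2∈blocks : ∀ a → 2 ∈ blocks (suc a)
2∈blocks zero = here refl
2∈blocks (suc a) = there (there (2∈blocks a))

within-block : ∀ b i → b ≤ i → i < 4 + b → i ≡ b + 0 ⊎ i ≡ b + 1 ⊎ i ≡ b + 2 ⊎ i ≡ b + 3
within-block b i b≤i i<4+b = offset (i ∸ b) (sym (m+[n∸m]≡n b≤i)) (subst (i ∸ b <_) (m+n∸n≡m 4 b) (∸-monoˡ-< i<4+b b≤i))
  where
  offset : ∀ e → i ≡ b + e → e < 4 → i ≡ b + 0 ⊎ i ≡ b + 1 ⊎ i ≡ b + 2 ⊎ i ≡ b + 3
  offset 0 p _ = inj₁ p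
  offset 1 p _ = inj₂ (inj₁ p)
  offset 2 p _ = inj₂ (inj₂ (inj₁ p))
  offset 3 p _ = inj₂ (inj₂ (inj₂ p))
  offset (suc (suc (suc (suc e)))) p (s≤s (s≤s (s≤s (s≤s ()))))

blocks-covering : ∀ t a i → i < a * 4 → ∃ λ d → d ∈ blocks a × Adjacent path t d i
blocks-covering t (suc a) i lt with i <? a * 4
... | yes earlier with blocks-covering t a i earlier
... | d , d∈ , adj = d , there (there d∈) , adj
blocks-covering t (suc a) i lt | no ¬earlier with within-block (a * 4) i (≮⇒≥ ¬earlier) lt
... | inj₁ refl = a * 4 + 1 , there (here refl) , inj₂ (sym (+-suc (a * 4) 0))
... | inj₂ (inj₁ refl) = a * 4 + 2 , here refl , inj₂ (sym (+-suc (a * 4) 1))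
... | inj₂ (inj₂ (inj₁ refl)) = a * 4 + 1 , there (here refl) , inj₁ (sym (+-suc (a * 4) 1))
... | inj₂ (inj₂ (inj₂ refl)) = a * 4 + 2 , here refl , inj₁ (sym (+-suc (a * 4) 2))

blocks-below : ∀ {a x t} → x + 2 ≤ a * 4 → a * 4 ≤ t → x < t
blocks-below {x = x} p q = ≤-trans (subst (_≤ x + 2) (+-comm x 1) (+-monoʳ-≤ x (s≤s z≤n))) (≤-trans p q)

plan-0mod4 : ∀ a → ColumnPlan (suc a * 4)
plan-0mod4 a = record
  { columns = blocks (suc a)
  ; bounded = All.map (λ p → blocks-below {suc a} p ≤-refl) (blocks-bounded (suc a))
  ; distinct = blocks-distinct (suc a)
  ; covering = blocks-covering (suc a * 4) (suc a)
  ; 1∈ = 1∈blocks a ; 2∈ = 2∈blocks a }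

plan-3mod4 : ∀ a → ColumnPlan (3 + a * 4)
plan-3mod4 a = record
  { columns = blocks (suc a)
  ; bounded = All.map below (blocks-bounded (suc a))
  ; distinct = blocks-distinct (suc a)
  ; covering = λ i lt → blocks-covering (3 + a * 4) (suc a) i (m≤n⇒m≤1+n lt)
  ; 1∈ = 1∈blocks a ; 2∈ = 2∈blocks a }
  where
  below : ∀ {x} → x + 2 ≤ 4 + a * 4 → x < 3 + a * 4
  below {x} p = ≤-pred (subst (_≤ 4 + a * 4) (+-comm x 2) p)

plan-1mod4 : ∀ a → ColumnPlan (1 + suc a * 4)
plan-1mod4 a = record
  { columns = (a * 4 + 3) ∷ blocks (suc a)
  ; bounded = last< ∷ All.map (λ p → blocks-below {suc a} p (n≤1+n _)) (blocks-bounded (suc a))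
  ; distinct = all-below⇒fresh (All.map below-last (blocks-bounded (suc a))) ∷ blocks-distinct (suc a)
  ; covering = covering′
  ; 1∈ = there (1∈blocks a) ; 2∈ = there (2∈blocks a) }
  where
  last< : a * 4 + 3 < 1 + suc a * 4
  last< = s≤s (≤-trans (+-monoʳ-≤ (a * 4) (n≤1+n 3)) (≤-reflexive (+-comm (a * 4) 4)))
  below-last : ∀ {x} → x + 2 ≤ 4 + a * 4 → x < a * 4 + 3
  below-last {x} p = subst (suc x ≤_) (+-comm 3 (a * 4)) (≤-pred (subst (_≤ 4 + a * 4) (+-comm x 2) p))
  covering′ : ∀ i → i < 1 + suc a * 4 → ∃ λ d → d ∈ ((a * 4 + 3) ∷ blocks (suc a)) × Adjacent path (1 + suc a * 4) d i
  covering′ i lt with i <? suc a * 4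
  ... | yes earlier with blocks-covering (1 + suc a * 4) (suc a) i earlier
  ... | d , d∈ , adj = d , there d∈ , adj
  covering′ i lt | no ¬earlier =
    a * 4 + 3 , here refl , inj₁ (trans (sym (+-suc (a * 4) 3)) (trans (+-comm (a * 4) 4) (≤-antisym (≮⇒≥ ¬earlier) (≤-pred lt))))

plan-2mod4 : ∀ a → ColumnPlan (2 + suc a * 4)
plan-2mod4 a = record
  { columns = (B + 1) ∷ B ∷ blocks (suc a)
  ; bounded = ≤-reflexive (cong suc (+-comm B 1)) ∷ n≤1+n (suc B) ∷ All.map (λ p → blocks-below {suc a} p (m≤n+m B 2)) (blocks-bounded (suc a))
  ; distinct = all-below⇒fresh (m<m+n B (s≤s z≤n) ∷ All.map (λ p → ≤-trans (below-B p) (m≤m+n B 1)) (blocks-bounded (suc a)))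
             ∷ all-below⇒fresh (All.map below-B (blocks-bounded (suc a))) ∷ blocks-distinct (suc a)
  ; covering = covering′
  ; 1∈ = there (there (1∈blocks a)) ; 2∈ = there (there (2∈blocks a)) }
  where
  B = suc a * 4
  below-B : ∀ {x} → x + 2 ≤ B → x < B
  below-B p = blocks-below {suc a} p ≤-refl
  covering′ : ∀ i → i < 2 + B → ∃ λ d → d ∈ ((B + 1) ∷ B ∷ blocks (suc a)) × Adjacent path (2 + B) d i
  covering′ i lt with i <? B
  ... | yes earlier with blocks-covering (2 + B) (suc a) i earlier
  ... | d , d∈ , adj = d , there (there d∈) , adj
  covering′ i lt | no ¬earlier with i ≟ B
  ... | yes refl = B + 1 , here refl , inj₂ (+-comm 1 B)
  ... | no i≢B = B , there (here refl) , inj₁ (≤-antisym (≤∧≢⇒< (≮⇒≥ ¬earlier) (λ e → i≢B (sym e))) (≤-pred lt))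

PDN : Graph → ℕ → Set
PDN = PowerDominationNumberIs

pdn-from-plan : ∀ k t′ n′ (P : ColumnPlan (suc t′)) T → length (columns P) ≡ T →
  (∀ F → LoadBound k (suc t′) n′ F → T ≤ F) → PDN (Board k (suc t′) (suc (suc n′))) T
pdn-from-plan k t′ n′ P T refl bound = pd-upper-bound k t′ n′ P , pd-lower-bound k (suc t′) (suc (suc n′)) T bound

-- Small boards

∧-elim : ∀ {a b} → a ∧ b ≡ true → a ≡ true × b ≡ true
∧-elim {true} {true} refl = refl , refl

∨-elim : ∀ {a b} → a ∨ b ≡ true → a ≡ true ⊎ b ≡ true
∨-elim {true} _ = inj₁ refl
∨-elim {false} p = inj₂ p

all-sound : ∀ {A : Set} (f : A → Bool) {xs x} → all f xs ≡ true → x ∈ xs → f x ≡ true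
all-sound f {y ∷ ys} p (here refl) = proj₁ (∧-elim p)
all-sound f {y ∷ ys} p (there x∈ys) = all-sound f (proj₂ (∧-elim {f y} p)) x∈ys

any-sound : ∀ {A : Set} (f : A → Bool) xs → any f xs ≡ true → ∃ λ x → x ∈ xs × f x ≡ true
any-sound f (y ∷ ys) p with f y in eq
... | true = y , here refl , eq
... | false with any-sound f ys p
... | x , x∈ys , fx = x , there x∈ys , fx

keep : ∀ {A : Set} → (A → Bool) → List A → List A
keep p [] = []
keep p (x ∷ xs) = if p x then x ∷ keep p xs else keep p xs

keep⁺ : ∀ {A : Set} (p : A → Bool) {xs x} → x ∈ xs → p x ≡ true → x ∈ keep p xs
keep⁺ p {y ∷ ys} (here refl) px rewrite px = here refl
keep⁺ p {y ∷ ys} (there x∈ys) px with p y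
... | true = there (keep⁺ p x∈ys px)
... | false = keep⁺ p x∈ys px

keep⁻ : ∀ {A : Set} (p : A → Bool) xs {x} → x ∈ keep p xs → p x ≡ true
keep⁻ p (y ∷ ys) x∈ with p y in eq
keep⁻ p (y ∷ ys) (here refl) | true = eq
keep⁻ p (y ∷ ys) (there x∈) | true = keep⁻ p ys x∈
keep⁻ p (y ∷ ys) x∈ | false = keep⁻ p ys x∈

-- A lower-bound certificate for S is a vertex set C
-- containing N[S], missing some vertex, and such that no vertex of C has exactly one neighbour
-- outside C: then everything observed by S stays in C.
module Certificates (k : Kind) (t n : ℕ) where

  Vertex = Fin t × Fin n
  G = Board k t n

  vertices : List Vertex
  vertices = cartesianProduct (allFin t) (allFin n)

  ∈-vertices : ∀ v → v ∈ vertices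
  ∈-vertices (a , b) = ∈-cartesianProduct⁺ (∈-allFin a) (∈-allFin b)

  _≟V_ : (u v : Vertex) → Dec (u ≡ v)
  _≟V_ = ≡-dec Fin._≟_ Fin._≟_

  adjacent : Vertex → Vertex → Bool
  adjacent u v = does (Adjacent? k t (toℕ (proj₁ u)) (toℕ (proj₁ v))) ∧ not (does (proj₂ u Fin.≟ proj₂ v))

  adjacent-complete : ∀ u v → _~_ G u v → adjacent u v ≡ true
  adjacent-complete u v (a , ne) with Adjacent? k t (toℕ (proj₁ u)) (toℕ (proj₁ v)) | proj₂ u Fin.≟ proj₂ v
  ... | yes _ | no _ = refl
  ... | no ¬a | _ = ⊥-elim (¬a a)
  ... | yes _ | yes e = ⊥-elim (ne e)

  adjacent-sound : ∀ u v → adjacent u v ≡ true → _~_ G u v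
  adjacent-sound u v p with Adjacent? k t (toℕ (proj₁ u)) (toℕ (proj₁ v)) | proj₂ u Fin.≟ proj₂ v
  ... | yes a | no ne = a , ne
  adjacent-sound u v () | no _ | _
  adjacent-sound u v () | yes _ | yes _

  different : Vertex → Vertex → Bool
  different u v = not (does (u ≟V v))

  notSingleton : List Vertex → Bool
  notSingleton [] = true
  notSingleton (x ∷ xs) = any (different x) xs

  notSingleton-sound : ∀ xs w → notSingleton xs ≡ true → w ∈ xs → ∃ λ x → x ∈ xs × x ≢ w
  notSingleton-sound (x ∷ xs) w p w∈ with x ≟V w
  ... | no x≢w = x , here refl , x≢w
  ... | yes refl with any-sound (different x) xs p
  ... | y , y∈ , dy = y , there y∈ , y≢x dy
    where
    y≢x : ∀ {y} → different x y ≡ true → y ≢ x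
    y≢x dy refl with x ≟V x
    y≢x () refl | yes _
    ... | no x≢x = x≢x refl

  outside : (Vertex → Bool) → Vertex → List Vertex
  outside C u = keep (λ x → adjacent u x ∧ not (C x)) vertices

  stalls : List Vertex → (Vertex → Bool) → Bool
  stalls S C = all (λ s → C s ∧ all (λ v → not (adjacent s v) ∨ C v) vertices) S
             ∧ (all (λ u → not (C u) ∨ notSingleton (outside C u)) vertices
             ∧ any (λ v → not (C v)) vertices)

  observed⇒∈ : ∀ S C → stalls S C ≡ true → ∀ v → Observed G S v → C v ≡ true
  observed⇒∈ S C p v (dom-self v∈S) = proj₁ (∧-elim (all-sound _ (proj₁ (∧-elim p)) v∈S))
  observed⇒∈ S C p v (dom-nbr {u} u∈S a)
    with ∨-elim {not (adjacent u v)} (all-sound (λ v → not (adjacent u v) ∨ C v) (proj₂ (∧-elim {C u} (all-sound _ (proj₁ (∧-elim p)) u∈S))) (∈-vertices v))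
  ... | inj₂ Cv = Cv
  ... | inj₁ q rewrite adjacent-complete u v a = ⊥-elim (false≢true q)
    where false≢true : false ≡ true → ⊥
          false≢true ()
  observed⇒∈ S C p w (propagate {u} obs-u a rest) with C w in Cw
  ... | true = refl
  ... | false
    with ∨-elim {not (C u)} (all-sound (λ u → not (C u) ∨ notSingleton (outside C u)) (proj₁ (∧-elim (proj₂ (∧-elim {all (λ s → C s ∧ all (λ v → not (adjacent s v) ∨ C v) vertices) S} p)))) (∈-vertices u))
  ... | inj₁ q rewrite observed⇒∈ S C p u obs-u = ⊥-elim (false≢true q)
    where false≢true : false ≡ true → ⊥
          false≢true ()
  ... | inj₂ q with notSingleton-sound (outside C u) w q (keep⁺ (λ x → adjacent u x ∧ not (C x)) (∈-vertices w) (adjacent-outside (adjacent-complete u w a) Cw))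
    where
    adjacent-outside : ∀ {a b} → a ≡ true → b ≡ false → a ∧ not b ≡ true
    adjacent-outside refl refl = refl
  ... | x , x∈ , x≢w with ∧-elim (keep⁻ (λ x → adjacent u x ∧ not (C x)) vertices x∈)
  ... | ax , ¬Cx rewrite observed⇒∈ S C p x (rest x (adjacent-sound u x ax) x≢w) = ⊥-elim (false≢true ¬Cx)
    where false≢true : false ≡ true → ⊥
          false≢true ()

  stalls⇒¬pd : ∀ S C → stalls S C ≡ true → ¬ (∀ v → Observed G S v)
  stalls⇒¬pd S C p pd with any-sound (λ v → not (C v)) vertices (proj₂ (∧-elim (proj₂ (∧-elim {all (λ s → C s ∧ all (λ v → not (adjacent s v) ∨ C v) vertices) S} p))))
  ... | v , _ , ¬Cv rewrite observed⇒∈ S C p v (pd v) = ⊥-elim (false≢true ¬Cv)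
    where false≢true : not true ≡ true → ⊥
          false≢true ()

  member : Vertex → List Vertex → Bool
  member x [] = false
  member x (y ∷ ys) = does (x ≟V y) ∨ member x ys

  member-sound : ∀ x ys → member x ys ≡ true → x ∈ ys
  member-sound x (y ∷ ys) p with x ≟V y
  ... | yes refl = here refl
  ... | no _ = there (member-sound x ys p)

  forceRound : List Vertex → List Vertex → List Vertex
  forceRound [] known = known
  forceRound (u ∷ us) known with keep (λ x → adjacent u x ∧ not (member x known)) vertices
  ... | w ∷ [] = forceRound us (w ∷ known)
  ... | _ = forceRound us known

  forceRounds : ℕ → List Vertex → List Vertex
  forceRounds zero known = known
  forceRounds (suc r) known = forceRounds r (forceRound known known)

  closedNeighbourhood : List Vertex → List Vertex
  closedNeighbourhood [] = []
  closedNeighbourhood (s ∷ ss) = s ∷ (keep (adjacent s) vertices ++ closedNeighbourhood ss)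

  module _ (S : List Vertex) where

    Obs = Observed G S

    forceRound-sound : ∀ us known → All Obs us → All Obs known → All Obs (forceRound us known)
    forceRound-sound [] known _ obs = obs
    forceRound-sound (u ∷ us) known (obs-u ∷ obs-us) obs with keep (λ x → adjacent u x ∧ not (member x known)) vertices in eq
    ... | [] = forceRound-sound us known obs-us obs
    ... | _ ∷ _ ∷ _ = forceRound-sound us known obs-us obs
    ... | w ∷ [] = forceRound-sound us (w ∷ known) obs-us (obs-w ∷ obs)
      where
      w∈ : w ∈ keep (λ x → adjacent u x ∧ not (member x known)) vertices
      w∈ rewrite eq = here refl
      obs-w : Obs w
      obs-w = propagate obs-u (adjacent-sound u w (proj₁ (∧-elim (keep⁻ _ vertices w∈)))) rest
        where
        rest : ∀ x → _~_ G u x → x ≢ w → Obs x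
        rest x a x≢w with member x known in mx
        ... | true = All.lookup obs (member-sound x known mx)
        ... | false with subst (x ∈_) eq (keep⁺ (λ x → adjacent u x ∧ not (member x known)) (∈-vertices x) (unknown (adjacent-complete u x a) mx))
          where unknown : ∀ {a b} → a ≡ true → b ≡ false → a ∧ not b ≡ true
                unknown refl refl = refl
        ... | here e = ⊥-elim (x≢w e)

    forceRounds-sound : ∀ r known → All Obs known → All Obs (forceRounds r known)
    forceRounds-sound zero known obs = obs
    forceRounds-sound (suc r) known obs = forceRounds-sound r (forceRound known known) (forceRound-sound known known obs obs)

    closedNeighbourhood-sound : ∀ ss → (∀ s → s ∈ ss → s ∈ S) → All Obs (closedNeighbourhood ss)
    closedNeighbourhood-sound [] _ = []
    closedNeighbourhood-sound (s ∷ ss) ss⊆S = dom-self (ss⊆S s (here refl)) ∷ ++⁺ (neighbours vertices) (closedNeighbourhood-sound ss (λ x m → ss⊆S x (there m)))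
      where
      neighbours : ∀ xs → All Obs (keep (adjacent s) xs)
      neighbours [] = []
      neighbours (x ∷ xs) with adjacent s x in a
      ... | true = dom-nbr (ss⊆S s (here refl)) (adjacent-sound s x a) ∷ neighbours xs
      ... | false = neighbours xs

    forcing-saturates⇒pd : ∀ r → all (λ v → member v (forceRounds r (closedNeighbourhood S))) vertices ≡ true → ∀ v → Obs v
    forcing-saturates⇒pd r p v = All.lookup (forceRounds-sound r (closedNeighbourhood S) (closedNeighbourhood-sound S (λ _ m → m)))
                                     (member-sound v _ (all-sound (λ v → member v (forceRounds r (closedNeighbourhood S))) p (∈-vertices v)))

Observed-mono : ∀ {G : Graph} {S S′ : List (V G)} → (∀ v → v ∈ S → v ∈ S′) → ∀ {v} → Observed G S v → Observed G S′ v
Observed-mono S⊆S′ (dom-self v∈S) = dom-self (S⊆S′ _ v∈S)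
Observed-mono S⊆S′ (dom-nbr u∈S a) = dom-nbr (S⊆S′ _ u∈S) a
Observed-mono S⊆S′ (propagate obs a rest) = propagate (Observed-mono S⊆S′ obs) a (λ x ax x≢w → Observed-mono S⊆S′ (rest x ax x≢w))

⊆-single : ∀ {A : Set} (d : A) (S : List A) → length S ≤ 1 → ∃ λ x → ∀ v → v ∈ S → v ∈ x ∷ []
⊆-single d [] _ = d , λ v ()
⊆-single d (a ∷ []) _ = a , λ v v∈ → v∈
⊆-single d (a ∷ b ∷ S) (s≤s ())

⊆-pair : ∀ {A : Set} (d : A) (S : List A) → length S ≤ 2 → ∃ λ x → ∃ λ y → ∀ v → v ∈ S → v ∈ x ∷ y ∷ []
⊆-pair d [] _ = d , d , λ v ()
⊆-pair d (a ∷ []) _ = a , a , λ { v (here e) → here e }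
⊆-pair d (a ∷ b ∷ []) _ = a , b , λ v v∈ → v∈
⊆-pair d (a ∷ b ∷ c ∷ S) (s≤s (s≤s ()))

module SmallBoard (k : Kind) (t′ n′ : ℕ) where

  open Certificates k (suc t′) (suc n′)

  no-pd-of-size1 : (cert : Vertex → Vertex → Bool) → all (λ x → stalls (x ∷ []) (cert x)) vertices ≡ true →
    ∀ S → IsPowerDominating G S → 2 ≤ length S
  no-pd-of-size1 cert checked S (_ , pd) with 2 ≤? length S
  ... | yes p = p
  ... | no ¬p with ⊆-single (fz , fz) S (≤-pred (≰⇒> ¬p))
  ... | x , S⊆x = ⊥-elim (stalls⇒¬pd (x ∷ []) (cert x) (all-sound (λ x → stalls (x ∷ []) (cert x)) checked (∈-vertices x)) (λ v → Observed-mono S⊆x (pd v)))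

  no-pd-of-size2 : (cert : Vertex → Vertex → Vertex → Bool) → all (λ x → all (λ y → stalls (x ∷ y ∷ []) (cert x y)) vertices) vertices ≡ true →
    ∀ S → IsPowerDominating G S → 3 ≤ length S
  no-pd-of-size2 cert checked S (_ , pd) with 3 ≤? length S
  ... | yes p = p
  ... | no ¬p with ⊆-pair (fz , fz) S (≤-pred (≰⇒> ¬p))
  ... | x , y , S⊆xy = ⊥-elim (stalls⇒¬pd (x ∷ y ∷ []) (cert x y)
          (all-sound (λ y → stalls (x ∷ y ∷ []) (cert x y)) (all-sound (λ x → all (λ y → stalls (x ∷ y ∷ []) (cert x y)) vertices) checked (∈-vertices x)) (∈-vertices y)) (λ v → Observed-mono S⊆xy (pd v)))

column row : ∀ {t n} → Fin t × Fin n → ℕ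
column v = toℕ (proj₁ v)
row v = toℕ (proj₂ v)

no-empty-pd : ∀ {G : Graph} (v : V G) → ∀ S → IsPowerDominating G S → 1 ≤ length S
no-empty-pd v [] (_ , pd) = ⊥-elim (unobserved (pd v))
  where
  unobserved : ∀ {w} → ¬ Observed _ [] w
  unobserved (propagate o _ _) = unobserved o
no-empty-pd v (_ ∷ _) _ = s≤s z≤n

γ-P2×K3 : PDN (Board path 2 3) 1
γ-P2×K3 = (S , ([] ∷ [] , forcing-saturates⇒pd S 4 refl) , refl) , no-empty-pd (fz , fz)
  where
  open Certificates path 2 3
  S = (# 0 , # 0) ∷ []

γ-P3×K3 : PDN (Board path 3 3) 2
γ-P3×K3 = pd-upper-bound path 2 1 (plan-3mod4 0) , SmallBoard.no-pd-of-size1 path 2 2 certificate refl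
  where
  certificate : Fin 3 × Fin 3 → Fin 3 × Fin 3 → Bool
  certificate x v with column x ≡ᵇ 1
  ... | true = not (not (column v ≡ᵇ 1) ∧ (row v ≡ᵇ row x))
  ... | false = ((column v ≡ᵇ column x) ∧ (row v ≡ᵇ row x)) ∨ ((column v ≡ᵇ 1) ∧ not (row v ≡ᵇ row x))

γ-C3×K3 : PDN (Board cycle 3 3) 2
γ-C3×K3 = pd-upper-bound cycle 2 1 (plan-3mod4 0) , SmallBoard.no-pd-of-size1 cycle 2 2 certificate refl
  where
  certificate : Fin 3 × Fin 3 → Fin 3 × Fin 3 → Bool
  certificate x v = not ((column v ≡ᵇ column x) xor (row v ≡ᵇ row x))

γ-C4×K2 : PDN (Board cycle 4 2) 2
γ-C4×K2 = pd-upper-bound cycle 3 0 (plan-0mod4 0) , SmallBoard.no-pd-of-size1 cycle 3 1 certificate refl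
  where
  certificate : Fin 4 × Fin 2 → Fin 4 × Fin 2 → Bool
  certificate x v = not (isEven (column v + row v) xor isEven (column x + row x))

γ-C6×K3 : PDN (Board cycle 6 3) 3
γ-C6×K3 = (S , (S-distinct , forcing-saturates⇒pd S 6 refl) , refl) , SmallBoard.no-pd-of-size2 cycle 5 2 certificate refl
  where
  open Certificates cycle 6 3
  S : List Vertex
  S = (# 0 , # 0) ∷ (# 0 , # 1) ∷ (# 3 , # 0) ∷ []
  S-distinct : Unique S
  S-distinct = ((λ ()) ∷ (λ ()) ∷ []) ∷ ((λ ()) ∷ []) ∷ [] ∷ []
  mod6 : ℕ → ℕ
  mod6 a = a % 6
  near : ℕ → ℕ → Bool
  near c d = (c ≡ᵇ d) ∨ (mod6 (c + 1) ≡ᵇ d) ∨ (mod6 (d + 1) ≡ᵇ c)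
  far-column : ℕ → ℕ → ℕ
  far-column cx cy = if not (near (mod6 (cx + 2)) cy) then mod6 (cx + 2)
                     else (if not (near (mod6 (cx + 3)) cy) then mod6 (cx + 3) else mod6 (cx + 4))
  certificate : Vertex → Vertex → Vertex → Bool
  certificate x y v with mod6 (column x + 3) ≡ᵇ column y
  ... | false = not (column v ≡ᵇ far-column (column x) (column y)) ∨ member v (x ∷ y ∷ [])
  ... | true with row x ≡ᵇ row y
  ...   | true = not (((column v ≡ᵇ column x) ∨ (column v ≡ᵇ column y)) xor (row v ≡ᵇ row x))
  ...   | false = not (row v ≡ᵇ (if (mod6 (column v + 6 ∸ column x) % 2) ≡ᵇ 0 then row y else row x))

-- The value for each residue of t modulo 4

≤-with-slack : ∀ {L t a} m → L ≡ a + t → a ≤ m + m → L ≤ m + m + t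
≤-with-slack {t = t} m refl a≤2m = +-monoˡ-≤ t a≤2m

γ-0mod4 : ∀ k q m → q * 2 ≤ m → 1 ≤ m → PDN (Board k (suc q * 4) (2 + m)) (suc q * 2)
γ-0mod4 k q m q*2≤m 1≤m = pdn-from-plan k (3 + q * 4) m (plan-0mod4 q) _ (length-blocks (suc q))
  (λ _ → LoadBound⇒≥ (suc q * 2) (≤-trans (≤-reflexive (double q)) (n≤1+n _)) (enough q q*2≤m) tight)
  where
  double : ∀ q → suc q * 2 + suc q * 2 ≡ suc q * 4
  double = solve-∀
  enough : ∀ q → q * 2 ≤ m → suc q * 2 ≤ m + m
  enough zero _ = +-mono-≤ 1≤m 1≤m
  enough (suc q) q*2≤m = ≤-trans (≤-reflexive (split q)) (+-mono-≤ q*2≤m (≤-trans (s≤s (s≤s z≤n)) q*2≤m))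
    where split : ∀ q → suc (suc q) * 2 ≡ suc q * 2 + 2
          split = solve-∀
  tight : suc q * 2 + suc q * 2 + 2 ≤ m + m + suc q * 4
  tight = ≤-with-slack m (lhs q) (+-mono-≤ 1≤m 1≤m)
    where lhs : ∀ q → suc q * 2 + suc q * 2 + 2 ≡ 2 + suc q * 4
          lhs = solve-∀

γ-1mod4 : ∀ k q m → 3 + q * 4 ≤ m → PDN (Board k (1 + suc q * 4) (2 + m)) (3 + q * 2)
γ-1mod4 k q m t≤m = pdn-from-plan k (suc q * 4) m (plan-1mod4 q) _ (cong suc (length-blocks (suc q)))
  (λ _ → LoadBound⇒≥ (3 + q * 2) (≤-reflexive (double q)) enough tight)
  where
  double : ∀ q → (3 + q * 2) + (3 + q * 2) ≡ suc (1 + suc q * 4)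
  double = solve-∀
  3≤m : 3 ≤ m
  3≤m = ≤-trans (m≤m+n 3 (q * 4)) t≤m
  enough : 3 + q * 2 ≤ m + m
  enough = ≤-trans (≤-trans (+-monoʳ-≤ 3 (*-monoʳ-≤ q (s≤s (s≤s z≤n)))) t≤m) (m≤m+n m m)
  tight : (3 + q * 2) + (3 + q * 2) + 2 ≤ m + m + (1 + suc q * 4)
  tight = ≤-with-slack m (lhs q) (≤-trans 3≤m (m≤m+n m m))
    where lhs : ∀ q → (3 + q * 2) + (3 + q * 2) + 2 ≡ 3 + (1 + suc q * 4)
          lhs = solve-∀

γ-3mod4 : ∀ k q m → 1 + q * 4 ≤ m → 2 ≤ m → PDN (Board k (3 + q * 4) (2 + m)) (suc q * 2)
γ-3mod4 k q m t≤m 2≤m = pdn-from-plan k (2 + q * 4) m (plan-3mod4 q) _ (length-blocks (suc q))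
  (λ _ → LoadBound⇒≥ (suc q * 2) (≤-reflexive (double q)) enough tight)
  where
  double : ∀ q → suc q * 2 + suc q * 2 ≡ suc (3 + q * 4)
  double = solve-∀
  enough : suc q * 2 ≤ m + m
  enough = ≤-trans (≤-reflexive (split q)) (+-mono-≤ (≤-trans (+-monoʳ-≤ 1 (*-monoʳ-≤ q (s≤s (s≤s z≤n)))) t≤m) (≤-trans (s≤s z≤n) 2≤m))
    where split : ∀ q → suc q * 2 ≡ (1 + q * 2) + 1
          split = solve-∀
  tight : suc q * 2 + suc q * 2 + 2 ≤ m + m + (3 + q * 4)
  tight = ≤-with-slack m (lhs q) (≤-trans (n≤1+n 3) (+-mono-≤ 2≤m 2≤m))
    where lhs : ∀ q → suc q * 2 + suc q * 2 + 2 ≡ 3 + (3 + q * 4)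
          lhs = solve-∀

isEven-*4 : ∀ q → isEven (q * 4) ≡ true
isEven-*4 zero = refl
isEven-*4 (suc q) = isEven-*4 q

γ-2mod4 : ∀ k q m → 1 + q * 2 ≤ m → 2 ≤ m → PDN (Board k (2 + suc q * 4) (2 + m)) (2 + suc q * 2)
γ-2mod4 k q m 1+q*2≤m 2≤m = pdn-from-plan k (1 + suc q * 4) m (plan-2mod4 q) _ (cong (suc ∘ suc) (length-blocks (suc q)))
  (λ _ → LoadBound⇒≥-bipartite (suc q) (λ _ → isEven-*4 q) (enough q 1+q*2≤m) tight)
  where
  enough : ∀ q → 1 + q * 2 ≤ m → 2 + suc q * 2 ≤ m + m
  enough zero _ = +-mono-≤ 2≤m 2≤m
  enough (suc q) 1+q*2≤m = ≤-trans (≤-reflexive (split q)) (+-mono-≤ 1+q*2≤m (≤-trans (s≤s (s≤s (s≤s z≤n))) 1+q*2≤m))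
    where split : ∀ q → 2 + suc (suc q) * 2 ≡ (1 + suc q * 2) + 3
          split = solve-∀
  tight : (2 + suc q * 2) + (2 + suc q * 2) + 2 ≤ m + m + (2 + suc q * 4)
  tight = ≤-with-slack m (lhs q) (+-mono-≤ 2≤m 2≤m)
    where lhs : ∀ q → (2 + suc q * 2) + (2 + suc q * 2) + 2 ≡ 4 + (2 + suc q * 4)
          lhs = solve-∀

γ-P2×K : ∀ m → 2 ≤ m → PDN (Board path 2 (2 + m)) 2
γ-P2×K m 2≤m = (S , (((λ ()) ∷ []) ∷ [] ∷ [] , observed) , refl) ,
  pd-lower-bound path 2 (2 + m) 2 (λ _ → LoadBound⇒≥-bipartite 0 (λ ()) (+-mono-≤ (≤-trans (s≤s z≤n) 2≤m) (≤-trans (s≤s z≤n) 2≤m)) (+-monoˡ-≤ 2 (+-mono-≤ 2≤m 2≤m)))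
  where
  S : List (Fin 2 × Fin (2 + m))
  S = (fz , fz) ∷ (fs fz , fz) ∷ []
  observed : ∀ v → Observed (Board path 2 (2 + m)) S v
  observed (c , z) with z Fin.≟ fz
  observed (fz , z) | yes refl = dom-self (here refl)
  observed (fs fz , z) | yes refl = dom-self (there (here refl))
  observed (fz , z) | no z≢0 = dom-nbr (there (here refl)) (inj₂ refl , λ e → z≢0 (sym e))
  observed (fs fz , z) | no z≢0 = dom-nbr (here refl) (inj₁ refl , λ e → z≢0 (sym e))

Shape : Kind → ℕ → Set
Shape k t = (k ≡ path × 2 ≤ t) ⊎ (k ≡ cycle × 3 ≤ t)

Size : Kind → ℕ → ℕ → Set
Size k t n = (t % 2 ≡ 1 × t ≤ n) ⊎ (t % 2 ≡ 0 × ((k ≡ path × ⌊ t /2⌋ + 2 ≤ n) ⊎ (k ≡ cycle × ⌊ t /2⌋ ≤ n)))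

Claim : Kind → ℕ → ℕ → Set
Claim k t n = (t % 4 ≢ 2 → PDN (Base k t ⊗ Complete n) ⌈ t /2⌉)
            × (t % 4 ≡ 2 → PDN (Base k t ⊗ Complete n) ⌊ t /2⌋ ⊎ PDN (Base k t ⊗ Complete n) (suc ⌊ t /2⌋))

Board≡Base : ∀ k {t n T} → PDN (Board k t n) T → PDN (Base k t ⊗ Complete n) T
Board≡Base path γ = γ
Board≡Base cycle γ = γ

Shape⇒2≤t : ∀ {k t} → Shape k t → 2 ≤ t
Shape⇒2≤t (inj₁ (_ , 2≤t)) = 2≤t
Shape⇒2≤t (inj₂ (_ , 3≤t)) = ≤-trans (n≤1+n 2) 3≤t

⌊r+q*4/2⌋ : ∀ r q → ⌊ r + q * 4 /2⌋ ≡ ⌊ r /2⌋ + q * 2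
⌊r+q*4/2⌋ r q = trans (cong ⌊_/2⌋ (+-comm r (q * 4))) (trans (halve q) (+-comm (q * 2) ⌊ r /2⌋))
  where
  halve : ∀ q → ⌊ q * 4 + r /2⌋ ≡ q * 2 + ⌊ r /2⌋
  halve zero = refl
  halve (suc q) = cong (suc ∘ suc) (halve q)

[r+q*4]%2 : ∀ r q → (r + q * 4) % 2 ≡ r % 2
[r+q*4]%2 r q = trans (cong (λ x → (r + x) % 2) (sym (*-assoc q 2 2))) ([m+kn]%n≡m%n r (q * 2) 2)

claim-ceil : ∀ {k n} r q → r % 4 ≢ 2 → PDN (Base k (r + q * 4) ⊗ Complete n) ⌈ r + q * 4 /2⌉ → Claim k (r + q * 4) n
claim-ceil r q r≢2 γ = (λ _ → γ) , (λ ≡2 → ⊥-elim (r≢2 (trans (sym ([m+kn]%n≡m%n r q 4)) ≡2)))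

claim-2mod4 : ∀ {k n} q → let t = 2 + q * 4 in
  PDN (Base k t ⊗ Complete n) ⌊ t /2⌋ ⊎ PDN (Base k t ⊗ Complete n) (suc ⌊ t /2⌋) → Claim k t n
claim-2mod4 q γ = (λ ≢2 → ⊥-elim (≢2 ([m+kn]%n≡m%n 2 q 4))) , (λ _ → γ)

odd-size : ∀ {k n} r q → r % 2 ≡ 1 → Size k (r + q * 4) n → r + q * 4 ≤ n
odd-size _ _ _ (inj₁ (_ , t≤n)) = t≤n
odd-size r q odd (inj₂ (even , _)) = ⊥-elim (1≢0 (trans (sym odd) (trans (sym ([r+q*4]%2 r q)) even)))
  where 1≢0 : 1 ≢ 0
        1≢0 ()

even-size : ∀ {k n} r q → r % 2 ≡ 0 → Size k (r + q * 4) n →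
  (k ≡ path × ⌊ r /2⌋ + q * 2 + 2 ≤ n) ⊎ (k ≡ cycle × ⌊ r /2⌋ + q * 2 ≤ n)
even-size r q even (inj₁ (odd , _)) = ⊥-elim (0≢1 (trans (sym even) (trans (sym ([r+q*4]%2 r q)) odd)))
  where 0≢1 : 0 ≢ 1
        0≢1 ()
even-size r q _ (inj₂ (_ , inj₁ (k≡path , h))) = inj₁ (k≡path , subst (λ x → x + 2 ≤ _) (⌊r+q*4/2⌋ r q) h)
even-size r q _ (inj₂ (_ , inj₂ (k≡cycle , h))) = inj₂ (k≡cycle , subst (_≤ _) (⌊r+q*4/2⌋ r q) h)

2+≤⇒ : ∀ {a} n → 2 + a ≤ n → ∃ λ m → n ≡ 2 + m × a ≤ m
2+≤⇒ (suc (suc m)) (s≤s (s≤s a≤m)) = m , refl , a≤m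

value-0mod4 : ∀ k q n → (k ≡ path × 2 + q * 2 + 2 ≤ n) ⊎ (k ≡ cycle × 2 + q * 2 ≤ n) →
  PDN (Base k (suc q * 4) ⊗ Complete n) (suc q * 2)
value-0mod4 path q n (inj₁ (_ , le)) with 2+≤⇒ n le
... | m , refl , h = γ-0mod4 path q m (≤-trans (m≤m+n (q * 2) 2) h) (≤-trans (≤-trans (s≤s z≤n) (m≤n+m 2 (q * 2))) h)
value-0mod4 cycle q n (inj₂ (_ , le)) with 2+≤⇒ n le
value-0mod4 cycle zero n _ | zero , refl , _ = γ-C4×K2
value-0mod4 cycle (suc q) n _ | zero , refl , ()
... | suc m , refl , h = γ-0mod4 cycle q (suc m) h (s≤s z≤n)

value-1mod4 : ∀ k q n → 1 + suc q * 4 ≤ n → PDN (Base k (1 + suc q * 4) ⊗ Complete n) (3 + q * 2)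
value-1mod4 k q n le with 2+≤⇒ n le
... | m , refl , h = Board≡Base k (γ-1mod4 k q m h)

value-3mod4 : ∀ k q n → 3 + q * 4 ≤ n → PDN (Base k (3 + q * 4) ⊗ Complete n) (suc q * 2)
value-3mod4 k q n le with 2+≤⇒ n le
value-3mod4 path zero n _ | suc zero , refl , _ = γ-P3×K3
value-3mod4 cycle zero n _ | suc zero , refl , _ = γ-C3×K3
value-3mod4 k (suc q) n _ | suc zero , refl , s≤s ()
... | suc (suc m) , refl , h = Board≡Base k (γ-3mod4 k q (2 + m) h (s≤s (s≤s z≤n)))

value-2mod4 : ∀ k q n → Shape k (2 + q * 4) → (k ≡ path × 1 + q * 2 + 2 ≤ n) ⊎ (k ≡ cycle × 1 + q * 2 ≤ n) →
  PDN (Base k (2 + q * 4) ⊗ Complete n) (1 + q * 2) ⊎ PDN (Base k (2 + q * 4) ⊗ Complete n) (2 + q * 2)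
value-2mod4 path q n _ (inj₁ (_ , le)) with 2+≤⇒ n (subst (_≤ n) (+-comm (1 + q * 2) 2) le)
value-2mod4 path zero n _ _ | suc zero , refl , _ = inj₁ γ-P2×K3
value-2mod4 path zero n _ _ | suc (suc m) , refl , _ = inj₂ (γ-P2×K (2 + m) (s≤s (s≤s z≤n)))
value-2mod4 path (suc q) n _ _ | m , refl , h =
  inj₂ (γ-2mod4 path q m (≤-trans (+-monoʳ-≤ 1 (*-monoˡ-≤ 2 (n≤1+n q))) h) (≤-trans (s≤s (s≤s z≤n)) h))
value-2mod4 cycle zero n (inj₁ (() , _)) _
value-2mod4 cycle zero n (inj₂ (_ , s≤s (s≤s ()))) _
value-2mod4 cycle (suc q) n _ (inj₂ (_ , le)) with 2+≤⇒ n le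
value-2mod4 cycle (suc zero) n _ _ | suc zero , refl , _ = inj₁ γ-C6×K3
value-2mod4 cycle (suc (suc q)) n _ _ | suc zero , refl , s≤s ()
... | suc (suc m) , refl , h = inj₂ (γ-2mod4 cycle q (2 + m) h (s≤s (s≤s z≤n)))

residue-0 : ∀ k q n → Shape k (0 + q * 4) → Size k (0 + q * 4) n → Claim k (0 + q * 4) n
residue-0 k zero n shape _ with Shape⇒2≤t shape
... | ()
residue-0 k (suc q) n _ size =
  claim-ceil {k} 0 (suc q) (λ ()) (subst (PDN _) (sym (cong (2 +_) (⌊r+q*4/2⌋ 1 q))) (value-0mod4 k q n (even-size {k} 0 (suc q) refl size)))

residue-1 : ∀ k q n → Shape k (1 + q * 4) → Size k (1 + q * 4) n → Claim k (1 + q * 4) n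
residue-1 k zero n shape _ with Shape⇒2≤t shape
... | s≤s ()
residue-1 k (suc q) n _ size =
  claim-ceil {k} 1 (suc q) (λ ()) (subst (PDN _) (sym (⌊r+q*4/2⌋ 2 (suc q))) (value-1mod4 k q n (odd-size {k} 1 (suc q) refl size)))

residue-2 : ∀ k q n → Shape k (2 + q * 4) → Size k (2 + q * 4) n → Claim k (2 + q * 4) n
residue-2 k q n shape size = claim-2mod4 {k} q (subst (λ h → PDN G h ⊎ PDN G (suc h)) (sym (⌊r+q*4/2⌋ 2 q))
  (value-2mod4 k q n shape (even-size {k} 2 q refl size)))
  where G = Base k (2 + q * 4) ⊗ Complete n

residue-3 : ∀ k q n → Shape k (3 + q * 4) → Size k (3 + q * 4) n → Claim k (3 + q * 4) n
residue-3 k q n _ size =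
  claim-ceil {k} 3 q (λ ()) (subst (PDN _) (sym (⌊r+q*4/2⌋ 4 q)) (value-3mod4 k q n (odd-size {k} 3 q refl size)))

theorem-by-residue : ∀ k t n r q → r < 4 → t ≡ r + q * 4 → Shape k t → Size k t n → Claim k t n
theorem-by-residue k _ n 0 q _ refl = residue-0 k q n
theorem-by-residue k _ n 1 q _ refl = residue-1 k q n
theorem-by-residue k _ n 2 q _ refl = residue-2 k q n
theorem-by-residue k _ n 3 q _ refl = residue-3 k q n
theorem-by-residue k _ n (suc (suc (suc (suc r)))) q (s≤s (s≤s (s≤s (s≤s ())))) _

theorem3p6 : (k : Kind) (t n : ℕ)
    → ((k ≡ path × 2 ≤ t) ⊎ (k ≡ cycle × 3 ≤ t))
    → ((t % 2 ≡ 1 × t ≤ n)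
       ⊎ (t % 2 ≡ 0 × ((k ≡ path × ⌊ t /2⌋ + 2 ≤ n) ⊎ (k ≡ cycle × ⌊ t /2⌋ ≤ n))))
    → ((t % 4 ≢ 2 → PowerDominationNumberIs (Base k t ⊗ Complete n) ⌈ t /2⌉)
       × (t % 4 ≡ 2 → PowerDominationNumberIs (Base k t ⊗ Complete n) ⌊ t /2⌋
                      ⊎ PowerDominationNumberIs (Base k t ⊗ Complete n) (suc ⌊ t /2⌋)))
theorem3p6 k t n = theorem-by-residue k t n (t % 4) (t / 4) (m%n<n t 4) (m≡m%n+[m/n]*n t 4)
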